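{- Let $q\geq 2$ be an even integer, $\omega=\exp(2\pi\sqrt{ -1}/q)$, let $m\geq 4$ be an integer, and let $\pi$ be a permutation of $\{0,1,\dots,m-3\}$. Let $e_0,\dots,e_{m-3},f_0,\dots,f_{m-3}\in\mathbb{Z}_q$. For $d\in\mathbb{Z}_2$ define the Boolean functions of $x_0,\dots,x_{m-3}$ $$\zeta^d=\sum_{\alpha=0}^{m-4}x_{\pi(\alpha)}x_{\pi(\alpha+1)}+d\,x_{\pi(m-3)},\qquad \eta^d=\sum_{\alpha=0}^{m-4}\bar{x}_{\pi(\alpha)}\bar{x}_{\pi(\alpha+1)}+\bar{d}\,x_{\pi(m-3)},$$ (with $\bar x=1-x$, $\bar d=1-d$), and the generalized Boolean function $g^d:\mathbb{Z}_2^m\to\mathbb{Z}_q$ $$g^d=\frac{q}{2}\Big[x_{m-2}\bar{x}_{m-1}\,\zeta^d+\bar{x}_{m-2}x_{m-1}\,\eta^d+d\,\bar{x}_{m-2}\bar{x}_{m-1}+x_{m-2}x_{m-1}\Big]+\sum_{i=0}^{m-3}e_ix_i+\sum_{i=0}^{m-3}f_i\bar{x}_i .$$ Let $\mathbf{a}=\Psi_{2^{m-2}-1}(g^0)$ and $\mathbf{b}=\Psi_{2^{m-2}-1}(g^1)$. Then $(\mathbf{a},\mathbf{b})$ is a Z-complementary pair of (even) length $2^m-2(2^{m-2}-1)=2^{m-1}+2$ with ZCZ width $2^{m-2}+2^{\pi(m-3)}+1$, i.e. $\rho_{\mathbf{a}}(\tau)+\rho_{\mathbf{b}}(\tau)=0$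 for all $1\leq\tau\leq 2^{m-2}+2^{\pi(m-3)}$.
   Context: For a function $f:\mathbb{Z}_2^m\to\mathbb{Z}_q$, $\Psi(f)$ denotes the length-$2^m$ sequence $(\omega^{f_0},\omega^{f_1},\dots,\omega^{f_{2^m-1}})$, where $f_i=f(r_{i,0},r_{i,1},\dots,r_{i,m-1})$ and $i=\sum_{j=0}^{m-1}r_{i,j}2^j$ is the binary expansion of $i$ (so $x_0$ corresponds to the least significant bit). For an integer $L\ge 0$, $\Psi_L(f)$ denotes the sequence obtained from $\Psi(f)$ by deleting its first $L$ and its last $L$ entries. For complex sequences $\mathbf{u}=(u_0,\dots,u_{N-1})$, the aperiodic autocorrelation is $\rho_{\mathbf{u}}(\tau)=\sum_{k=0}^{N-1-\tau}u_k\overline{u_{k+\tau}}$ for $0\le\tau\le N-1$ (and $0$ for $\tau\ge N$). A pair $(\mathbf{a},\mathbf{b})$ of length-$N$ sequences is a Z-complementary pair with ZCZ width $Z$ if $\rho_{\mathbf{a}}(\tau)+\rho_{\mathbf{b}}(\tau)=0$ for all $1\le\tau\le Z-1$; for $q=2$ and even $N$ this is called an even-length binary Z-complementary pair (EB-ZCP). -}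

module Defs where

open import Level using (Level)
open import Algebra.Bundles using (CommutativeRing)
open import Data.Nat using (ℕ; zero; suc; _+_; _*_; _∸_; _^_; _≤_; _<_)
open import Data.Nat.DivMod using (_/_; _%_)
open import Data.Fin using (Fin; toℕ; inject₁; fromℕ) renaming (suc to fsuc; zero to fzero)
open import Data.Fin.Permutation using (Permutation′; _⟨$⟩ʳ_)
open import Data.Sum using (_⊎_)
open import Data.Product using (_×_)
open import Relation.Nullary using (¬_)

-- Natural-number helpers (values of ℤ_q are represented by natural
-- number representatives; only their residue mod q matters since they
-- are only ever used as exponents of ω with ω ^ q = 1).

-- j-th binary digit of i (x_0 = least significant bit): ⌊i / 2^j⌋ mod 2
bit : ℕ → ℕ → ℕ
bit i zero    = i % 2
bit i (suc j) = bit (i / 2) j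

bar : ℕ → ℕ
bar x = 1 ∸ x

sumF : (k : ℕ) → (Fin k → ℕ) → ℕ
sumF zero    h = 0
sumF (suc k) h = h fzero + sumF k (λ j → h (fsuc j))

-- The functions of the theorem, with m = n + 4 (so m ≥ 4, m - 2 = n + 2,
-- m - 3 = n + 1, m - 4 = n).  π is a permutation of {0,…,m-3} = Fin (n+2).

ζ : (n : ℕ) → Permutation′ (suc (suc n)) → (d : ℕ) → (i : ℕ) → ℕ
ζ n π d i =
  sumF (suc n) (λ α → bit i (toℕ (π ⟨$⟩ʳ inject₁ α)) * bit i (toℕ (π ⟨$⟩ʳ fsuc α)))
  + d * bit i (toℕ (π ⟨$⟩ʳ fromℕ (suc n)))

η : (n : ℕ) → Permutation′ (suc (suc n)) → (d : ℕ) → (i : ℕ) → ℕ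
η n π d i =
  sumF (suc n) (λ α → bar (bit i (toℕ (π ⟨$⟩ʳ inject₁ α))) * bar (bit i (toℕ (π ⟨$⟩ʳ fsuc α))))
  + bar d * bit i (toℕ (π ⟨$⟩ʳ fromℕ (suc n)))

g : (q n : ℕ) → Permutation′ (suc (suc n)) → (e f : Fin (suc (suc n)) → Fin q)
    → (d : ℕ) → (i : ℕ) → ℕ
g q n π e f d i =
  (q / 2) * ( xa * bar xb * ζ n π d i
            + bar xa * xb * η n π d i
            + d * bar xa * bar xb
            + xa * xb )
  + sumF (suc (suc n)) (λ j → toℕ (e j) * bit i (toℕ j))
  + sumF (suc (suc n)) (λ j → toℕ (f j) * bar (bit i (toℕ j)))
  where
    xa = bit i (n + 2)
    xb = bit i (n + 3)

-- Ψ_L(h) as an exponent sequence: k-th entry is the exponent h (k + L)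
-- (its length is 2^m - 2L, recorded separately)
ΨL : (L : ℕ) → (ℕ → ℕ) → (ℕ → ℕ)
ΨL L h k = h (k + L)

-- The complex numbers are not available; we work in an
-- arbitrary commutative ring R which is an integral domain of
-- characteristic 0, with ω ∈ R a primitive q-th root of unity.  Any such
-- ℚ(ω) is isomorphic to the q-th cyclotomic field, so vanishing of an
-- integer combination of powers of ω in R is equivalent to vanishing of
-- the same combination of powers of exp(2πi/q) in ℂ.

module _ {c ℓ : Level} (R : CommutativeRing c ℓ) where
  open CommutativeRing R using (Carrier; _≈_; 0#; 1#) renaming (_+_ to _+R_; _*_ to _*R_)

  pow : Carrier → ℕ → Carrier
  pow x zero    = 1#
  pow x (suc k) = x *R pow x k

  fromℕR : ℕ → Carrier
  fromℕR zero    = 0#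
  fromℕR (suc k) = 1# +R fromℕR k

  IsIntegralDomain : Set (c Level.⊔ ℓ)
  IsIntegralDomain = ¬ (1# ≈ 0#) × (∀ x y → x *R y ≈ 0# → x ≈ 0# ⊎ y ≈ 0#)

  CharZero : Set ℓ
  CharZero = ∀ k → ¬ (fromℕR (suc k) ≈ 0#)

  IsPrimitiveRoot : ℕ → Carrier → Set ℓ
  IsPrimitiveRoot q ω = (pow ω q ≈ 1#) × (∀ k → 1 ≤ k → k < q → ¬ (pow ω k ≈ 1#))

  sumR : ℕ → (ℕ → Carrier) → Carrier
  sumR zero    h = 0#
  sumR (suc N) h = sumR N h +R h N

  -- Aperiodic autocorrelation of the length-N sequence u_k = ω^(s k):
  --   ρ(τ) = Σ_{k=0}^{N-1-τ} u_k · conj(u_{k+τ}),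
  -- where conj(ω^x) = ω^(-x) = ω^((q-1)·x) since ω^q = 1 and |ω| = 1.
  -- (For τ ≥ N the sum is empty, i.e. 0.)
  ρ : (q : ℕ) → (ω : Carrier) → (N : ℕ) → (s : ℕ → ℕ) → ℕ → Carrier
  ρ q ω N s τ = sumR (N ∸ τ) (λ k → pow ω (s k) *R pow ω ((q ∸ 1) * s (k + τ)))

  IsZCP : (q : ℕ) → (ω : Carrier) → (N : ℕ) → (a b : ℕ → ℕ) → (Z : ℕ) → Set ℓ
  IsZCP q ω N a b Z = ∀ τ → 1 ≤ τ → τ ≤ Z ∸ 1 → ρ q ω N a τ +R ρ q ω N b τ ≈ 0#

module Submission where

-- Write g^d = (q/2)·B^d + ℓ, where ℓ is the linear part. As ω^(q/2) = -1, the summand of ρ_a(τ) + ρ_b(τ) at the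
-- positions i, i′ = i + τ is (ε⁰ + ε¹)·ω^(ℓ(i) - ℓ(i′)) with signs ε^d = (-1)^(B^d(i) + B^d(i′)). Sort the indices
-- into quadrants by (x_{m-2}, x_{m-1}): the truncated sequences keep one index of quadrant 0, all of quadrants 1
-- and 2, and one of quadrant 3. Inside a run of pairs (i, i′) from fixed quadrants, toggle in both i and i′ the path
-- variable x_{π(v+1)} right after the last path position v where i and i′ disagree. This is an involution which
-- keeps ℓ(i) - ℓ(i′) and flips the parity of the brackets, so matched pairs cancel; an unmatched pair has ε⁰ = -ε¹.
-- The remaining boundary terms vanish or cancel each other, and τ ≤ 2^(m-2) + 2^π(m-3) is exactly what makes
-- the bit x_{π(m-3)} of τ - 2^(m-2) - 1 vanish.

module Binary where

  open import Defs
  open import Data.Nat using (ℕ; zero; suc; _+_; _*_; _^_; _≤_; _<_; z≤n; s≤s)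
  open import Data.Nat.Properties
  open import Data.Nat.DivMod
  open import Data.Sum using (_⊎_)
  open import Data.Product using (Σ-syntax; _×_; _,_)
  open import Data.Empty using (⊥-elim)
  open import Relation.Binary.PropositionalEquality
  open import Data.Nat.Tactic.RingSolver using (solve-∀)

  m%2≤1 : ∀ x → x % 2 ≤ 1
  m%2≤1 x = ≤-pred (m%n<n x 2)

  bit≤1 : ∀ x c → bit x c ≤ 1
  bit≤1 x zero    = m%2≤1 x
  bit≤1 x (suc c) = bit≤1 (x / 2) c

  bit-binary : ∀ x c → bit x c ≡ 0 ⊎ bit x c ≡ 1
  bit-binary x c = n≤1⇒n≡0∨n≡1 (bit≤1 x c)

  bit-zero-cons : ∀ b x → b ≤ 1 → bit (b + x * 2) 0 ≡ b
  bit-zero-cons b x b≤1 = trans ([m+kn]%n≡m%n b x 2) (m<n⇒m%n≡m (s≤s b≤1))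

  cons/2≡ : ∀ b x → b ≤ 1 → (b + x * 2) / 2 ≡ x
  cons/2≡ b x b≤1 = begin
    (b + x * 2) / 2    ≡⟨ +-distrib-/ b (x * 2) no-carry ⟩
    b / 2 + x * 2 / 2  ≡⟨ cong₂ _+_ (m<n⇒m/n≡0 (s≤s b≤1)) (m*n/n≡m x 2) ⟩
    x                  ∎
    where
    open ≡-Reasoning
    no-carry : b % 2 + x * 2 % 2 < 2
    no-carry = subst (_< 2) (sym (cong₂ _+_ (m<n⇒m%n≡m (s≤s b≤1)) (m*n%n≡0 x 2)))
                     (subst (_< 2) (sym (+-identityʳ b)) (s≤s b≤1))

  bit-suc-cons : ∀ b x c → b ≤ 1 → bit (b + x * 2) (suc c) ≡ bit x c
  bit-suc-cons b x c b≤1 = cong (λ z → bit z c) (cons/2≡ b x b≤1)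

  x≡bit+half*2 : ∀ x → x ≡ bit x 0 + (x / 2) * 2
  x≡bit+half*2 x = m≡m%n+[m/n]*n x 2

  half-< : ∀ x K → x < 2 ^ suc K → x / 2 < 2 ^ K
  half-< x K x< = m<n*o⇒m/o<n (subst (x <_) (*-comm 2 (2 ^ K)) x<)

  cons-< : ∀ b x K → b ≤ 1 → x < 2 ^ K → b + x * 2 < 2 ^ suc K
  cons-< b x K b≤1 x< = begin-strict
    b + x * 2  ≤⟨ +-monoˡ-≤ (x * 2) b≤1 ⟩
    1 + x * 2  <⟨ n<1+n _ ⟩
    suc x * 2  ≤⟨ *-monoˡ-≤ 2 x< ⟩
    2 ^ K * 2  ≡⟨ *-comm (2 ^ K) 2 ⟩
    2 ^ suc K  ∎
    where open ≤-Reasoning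

  bit-<2^ : ∀ x c → x < 2 ^ c → bit x c ≡ 0
  bit-<2^ .0 zero    (s≤s z≤n) = refl
  bit-<2^ x  (suc c) x<        = bit-<2^ (x / 2) c (half-< x c x<)

  bits-injective : ∀ K x y → x < 2 ^ K → y < 2 ^ K → (∀ c → c < K → bit x c ≡ bit y c) → x ≡ y
  bits-injective zero    .0 .0 (s≤s z≤n) (s≤s z≤n) _ = refl
  bits-injective (suc K) x  y  x<        y<        same = begin
    x                      ≡⟨ x≡bit+half*2 x ⟩
    bit x 0 + (x / 2) * 2  ≡⟨ cong₂ (λ b h → b + h * 2) (same 0 (s≤s z≤n)) halves ⟩
    bit y 0 + (y / 2) * 2  ≡⟨ x≡bit+half*2 y ⟨
    y                      ∎
    where
    open ≡-Reasoning
    halves : x / 2 ≡ y / 2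
    halves = bits-injective K (x / 2) (y / 2) (half-< x K x<) (half-< y K y<) (λ c c< → same (suc c) (s≤s c<))

  private
    +2^*-halve : ∀ K x w → x + 2 ^ suc K * w ≡ bit x 0 + (x / 2 + 2 ^ K * w) * 2
    +2^*-halve K x w = trans (cong (_+ 2 ^ suc K * w) (x≡bit+half*2 x)) (shift (bit x 0) (x / 2) (2 ^ K) w)
      where
      shift : ∀ b h P w → (b + h * 2) + 2 * P * w ≡ b + (h + P * w) * 2
      shift = solve-∀

  bit-+2^*-low : ∀ K x w → x < 2 ^ K → ∀ c → c < K → bit (x + 2 ^ K * w) c ≡ bit x c
  bit-+2^*-low (suc K) x w x< zero    _ =
    trans (cong (λ z → bit z 0) (+2^*-halve K x w)) (bit-zero-cons (bit x 0) (x / 2 + 2 ^ K * w) (m%2≤1 x))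
  bit-+2^*-low (suc K) x w x< (suc c) (s≤s c<) =
    trans (cong (λ z → bit z (suc c)) (+2^*-halve K x w))
          (trans (bit-suc-cons (bit x 0) (x / 2 + 2 ^ K * w) c (m%2≤1 x)) (bit-+2^*-low K (x / 2) w (half-< x K x<) c c<))

  bit-+2^*-high : ∀ K x w → x < 2 ^ K → ∀ c → bit (x + 2 ^ K * w) (K + c) ≡ bit w c
  bit-+2^*-high zero    .0 w (s≤s z≤n) c = cong (λ z → bit z c) (+-identityʳ w)
  bit-+2^*-high (suc K) x  w x<        c =
    trans (cong (λ z → bit z (suc K + c)) (+2^*-halve K x w))
          (trans (bit-suc-cons (bit x 0) (x / 2 + 2 ^ K * w) (K + c) (m%2≤1 x)) (bit-+2^*-high K (x / 2) w (half-< x K x<) c))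

  private
    +1-halve : ∀ x → bit x 0 ≡ 0 → x + 1 ≡ 1 + (x / 2) * 2
    +1-halve x b0 = trans (cong (_+ 1) (trans (x≡bit+half*2 x) (cong (_+ (x / 2) * 2) b0))) (+-comm ((x / 2) * 2) 1)

    +2^-halve : ∀ x c → x + 2 ^ suc c ≡ bit x 0 + (x / 2 + 2 ^ c) * 2
    +2^-halve x c = trans (cong (_+ 2 ^ suc c) (x≡bit+half*2 x)) (shift (bit x 0) (x / 2) (2 ^ c))
      where
      shift : ∀ b h P → (b + h * 2) + 2 * P ≡ b + (h + P) * 2
      shift = solve-∀

  bit-+2^-at : ∀ x c → bit x c ≡ 0 → bit (x + 2 ^ c) c ≡ 1
  bit-+2^-at x zero b0 = trans (cong (λ z → bit z 0) (+1-halve x b0)) (bit-zero-cons 1 (x / 2) (s≤s z≤n))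
  bit-+2^-at x (suc c) b0 =
    trans (cong (λ z → bit z (suc c)) (+2^-halve x c))
          (trans (bit-suc-cons (bit x 0) (x / 2 + 2 ^ c) c (m%2≤1 x)) (bit-+2^-at (x / 2) c b0))

  bit-+2^-elsewhere : ∀ x c → bit x c ≡ 0 → ∀ c′ → c′ ≢ c → bit (x + 2 ^ c) c′ ≡ bit x c′
  bit-+2^-elsewhere x zero    b0 zero     c′≢c = ⊥-elim (c′≢c refl)
  bit-+2^-elsewhere x zero    b0 (suc c′) _    =
    trans (cong (λ z → bit z (suc c′)) (+1-halve x b0)) (bit-suc-cons 1 (x / 2) c′ (s≤s z≤n))
  bit-+2^-elsewhere x (suc c) b0 zero     _    =
    trans (cong (λ z → bit z 0) (+2^-halve x c)) (bit-zero-cons (bit x 0) (x / 2 + 2 ^ c) (m%2≤1 x))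
  bit-+2^-elsewhere x (suc c) b0 (suc c′) c′≢c =
    trans (cong (λ z → bit z (suc c′)) (+2^-halve x c))
          (trans (bit-suc-cons (bit x 0) (x / 2 + 2 ^ c) c′ (m%2≤1 x))
                 (bit-+2^-elsewhere (x / 2) c b0 c′ (λ eq → c′≢c (cong suc eq))))

  +2^-< : ∀ K x c → x < 2 ^ K → c < K → bit x c ≡ 0 → x + 2 ^ c < 2 ^ K
  +2^-< (suc K) x zero    x< _        b0 =
    subst (_< 2 ^ suc K) (sym (+1-halve x b0)) (cons-< 1 (x / 2) K (s≤s z≤n) (half-< x K x<))
  +2^-< (suc K) x (suc c) x< (s≤s c<) b0 =
    subst (_< 2 ^ suc K) (sym (+2^-halve x c))
          (cons-< (bit x 0) (x / 2 + 2 ^ c) K (m%2≤1 x) (+2^-< K (x / 2) c (half-< x K x<) c< b0))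

  bit≡1⇒+2^ : ∀ x c → bit x c ≡ 1 → Σ[ y ∈ ℕ ] (x ≡ y + 2 ^ c) × bit y c ≡ 0
  bit≡1⇒+2^ x zero b1 =
    (x / 2) * 2 , trans (x≡bit+half*2 x) (trans (cong (_+ (x / 2) * 2) b1) (+-comm 1 _)) , bit-zero-cons 0 (x / 2) z≤n
  bit≡1⇒+2^ x (suc c) b1 with bit≡1⇒+2^ (x / 2) c b1
  ... | y , x/2≡ , y-bit = bit x 0 + y * 2 , x≡ , trans (bit-suc-cons (bit x 0) y c (m%2≤1 x)) y-bit
    where
    shift : ∀ b y P → b + (y + P) * 2 ≡ (b + y * 2) + 2 * P
    shift = solve-∀
    x≡ : x ≡ (bit x 0 + y * 2) + 2 ^ suc c
    x≡ = trans (x≡bit+half*2 x) (trans (cong (λ z → bit x 0 + z * 2) x/2≡) (shift (bit x 0) y (2 ^ c)))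

  private
    complement-digits : ∀ b b′ S P → b ≤ 1 → b′ ≤ 1 → b + b′ + 1 + S * 2 ≡ P * 2 → b′ ≡ bar b × suc S ≡ P
    complement-digits 0 0 S P _ _ eq with trans (sym (bit-zero-cons 1 S (s≤s z≤n))) (trans (cong (λ z → bit z 0) eq) (bit-zero-cons 0 P z≤n))
    ... | ()
    complement-digits 0 1 S P _ _ eq = refl , *-cancelʳ-≡ (suc S) P 2 eq
    complement-digits 1 0 S P _ _ eq = refl , *-cancelʳ-≡ (suc S) P 2 eq
    complement-digits 1 1 S P _ _ eq with trans (sym (bit-zero-cons 1 (suc S) (s≤s z≤n))) (trans (cong (λ z → bit z 0) eq) (bit-zero-cons 0 P z≤n))
    ... | ()
    complement-digits (suc (suc _)) _ _ _ (s≤s ()) _ _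
    complement-digits 0 (suc (suc _)) _ _ _ (s≤s ()) _
    complement-digits 1 (suc (suc _)) _ _ _ (s≤s ()) _

  bit-complement : ∀ K x y → x + y + 1 ≡ 2 ^ K → ∀ c → c < K → bit y c ≡ bar (bit x c)
  bit-complement (suc K) x y sum≡ c c< with complement-digits (bit x 0) (bit y 0) (x / 2 + y / 2) (2 ^ K) (bit≤1 x 0) (bit≤1 y 0) digits
    where
    regroup : ∀ b b′ h h′ → (b + h * 2) + (b′ + h′ * 2) + 1 ≡ b + b′ + 1 + (h + h′) * 2
    regroup = solve-∀
    digits : bit x 0 + bit y 0 + 1 + (x / 2 + y / 2) * 2 ≡ 2 ^ K * 2
    digits = begin
      bit x 0 + bit y 0 + 1 + (x / 2 + y / 2) * 2           ≡⟨ regroup (bit x 0) (bit y 0) (x / 2) (y / 2) ⟨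
      (bit x 0 + x / 2 * 2) + (bit y 0 + y / 2 * 2) + 1     ≡⟨ cong₂ (λ a b → a + b + 1) (x≡bit+half*2 x) (x≡bit+half*2 y) ⟨
      x + y + 1                                             ≡⟨ sum≡ ⟩
      2 * 2 ^ K                                             ≡⟨ *-comm 2 (2 ^ K) ⟩
      2 ^ K * 2                                             ∎
      where open ≡-Reasoning
  ... | low , high with c | c<
  ...   | zero  | _        = low
  ...   | suc c | s≤s c<K  = bit-complement K (x / 2) (y / 2) (trans (+-comm (x / 2 + y / 2) 1) high) c c<K

  b+bar≡1 : ∀ b → b ≤ 1 → b + bar b ≡ 1
  b+bar≡1 0 _ = refl
  b+bar≡1 1 _ = refl
  b+bar≡1 (suc (suc _)) (s≤s ())

  bar-involutive : ∀ b → b ≤ 1 → bar (bar b) ≡ b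
  bar-involutive 0 _ = refl
  bar-involutive 1 _ = refl
  bar-involutive (suc (suc _)) (s≤s ())

  ≢⇒bar≡ : ∀ b b′ → b ≤ 1 → b′ ≤ 1 → b ≢ b′ → bar b′ ≡ b
  ≢⇒bar≡ 0 0 _ _ b≢b′ = ⊥-elim (b≢b′ refl)
  ≢⇒bar≡ 0 1 _ _ _    = refl
  ≢⇒bar≡ 1 0 _ _ _    = refl
  ≢⇒bar≡ 1 1 _ _ b≢b′ = ⊥-elim (b≢b′ refl)
  ≢⇒bar≡ (suc (suc _)) _ (s≤s ()) _ _
  ≢⇒bar≡ 0 (suc (suc _)) _ (s≤s ()) _
  ≢⇒bar≡ 1 (suc (suc _)) _ (s≤s ()) _

  ≢⇒+≡1 : ∀ b b′ → b ≤ 1 → b′ ≤ 1 → b ≢ b′ → b + b′ ≡ 1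
  ≢⇒+≡1 b b′ b≤1 b′≤1 b≢b′ = trans (cong (b +_) (sym (≢⇒bar≡ b′ b b′≤1 b≤1 (λ eq → b≢b′ (sym eq))))) (b+bar≡1 b b≤1)

module NatSums where

  open import Data.Nat using (ℕ; zero; suc; _+_; _*_; _≤_; _<_; z≤n; s≤s)
  open import Data.Nat.Properties
  open import Data.Fin using (Fin; toℕ) renaming (zero to fzero; suc to fsuc)
  open import Relation.Binary.PropositionalEquality
  open import Data.Nat.Tactic.RingSolver using (solve-∀)
  open import Defs using (sumF)

  sumN : ℕ → (ℕ → ℕ) → ℕ
  sumN zero    h = 0
  sumN (suc k) h = h 0 + sumN k (λ i → h (suc i))

  -- Zero outside the range of toℕ.
  extend : ∀ {m} → (Fin m → ℕ) → ℕ → ℕ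
  extend {zero}  F i       = 0
  extend {suc m} F zero    = F fzero
  extend {suc m} F (suc i) = extend (λ j → F (fsuc j)) i

  extend-toℕ : ∀ {m} (F : Fin m → ℕ) (i : Fin m) → extend F (toℕ i) ≡ F i
  extend-toℕ {suc m} F fzero    = refl
  extend-toℕ {suc m} F (fsuc i) = extend-toℕ (λ j → F (fsuc j)) i

  sumF≡sumN : ∀ k (h : Fin k → ℕ) (H : ℕ → ℕ) → (∀ j → h j ≡ H (toℕ j)) → sumF k h ≡ sumN k H
  sumF≡sumN zero    h H eq = refl
  sumF≡sumN (suc k) h H eq = cong₂ _+_ (eq fzero) (sumF≡sumN k (λ j → h (fsuc j)) (λ i → H (suc i)) (λ j → eq (fsuc j)))

  sumN-cong : ∀ k h h′ → (∀ i → i < k → h i ≡ h′ i) → sumN k h ≡ sumN k h′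
  sumN-cong zero    h h′ eq = refl
  sumN-cong (suc k) h h′ eq = cong₂ _+_ (eq 0 (s≤s z≤n)) (sumN-cong k _ _ (λ i i< → eq (suc i) (s≤s i<)))

  sumN-+ : ∀ k h h′ → sumN k h + sumN k h′ ≡ sumN k (λ i → h i + h′ i)
  sumN-+ zero    h h′ = refl
  sumN-+ (suc k) h h′ =
    trans (interchange (h 0) (h′ 0) (sumN k _) (sumN k _)) (cong (h 0 + h′ 0 +_) (sumN-+ k _ _))
    where
    interchange : ∀ a b c d → a + c + (b + d) ≡ a + b + (c + d)
    interchange = solve-∀

  sumN-differ-at : ∀ k c h h′ → c < k → (∀ i → i ≢ c → h′ i ≡ h i) → sumN k h′ + h c ≡ sumN k h + h′ c
  sumN-differ-at (suc k) zero h h′ _ same =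
    trans (cong (λ z → h′ 0 + z + h 0) (sumN-cong k _ _ (λ i _ → same (suc i) (λ ()))))
          (swap (h′ 0) (h 0) (sumN k (λ i → h (suc i))))
    where
    swap : ∀ a b s → a + s + b ≡ b + s + a
    swap = solve-∀
  sumN-differ-at (suc k) (suc c) h h′ (s≤s c<) same = begin
    h′ 0 + sumN k h′∘suc + h (suc c)    ≡⟨ +-assoc (h′ 0) _ _ ⟩
    h′ 0 + (sumN k h′∘suc + h (suc c))  ≡⟨ cong₂ _+_ (same 0 (λ ())) (sumN-differ-at k c h∘suc h′∘suc c< same∘suc) ⟩
    h 0 + (sumN k h∘suc + h′ (suc c))   ≡⟨ +-assoc (h 0) _ _ ⟨
    h 0 + sumN k h∘suc + h′ (suc c)     ∎
    where
    open ≡-Reasoning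
    h∘suc h′∘suc : ℕ → ℕ
    h∘suc i = h (suc i)
    h′∘suc i = h′ (suc i)
    same∘suc : ∀ i → i ≢ c → h′∘suc i ≡ h∘suc i
    same∘suc i i≢c = same (suc i) (λ eq → i≢c (suc-injective eq))

  pathSum : ℕ → (ℕ → ℕ) → ℕ
  pathSum K y = sumN K (λ a → y a * y (suc a))

  leftNeighbour : (ℕ → ℕ) → ℕ → ℕ
  leftNeighbour y zero    = 0
  leftNeighbour y (suc v) = y v

  rightNeighbour : ℕ → (ℕ → ℕ) → ℕ → ℕ
  rightNeighbour zero    y u       = 0
  rightNeighbour (suc K) y zero    = y 1
  rightNeighbour (suc K) y (suc u) = rightNeighbour K (λ a → y (suc a)) u

  rightNeighbour-inner : ∀ K y u → u < K → rightNeighbour K y u ≡ y (suc u)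
  rightNeighbour-inner (suc K) y zero    _        = refl
  rightNeighbour-inner (suc K) y (suc u) (s≤s u<) = rightNeighbour-inner K (λ a → y (suc a)) u u<

  rightNeighbour-end : ∀ K y → rightNeighbour K y K ≡ 0
  rightNeighbour-end zero    y = refl
  rightNeighbour-end (suc K) y = rightNeighbour-end K (λ a → y (suc a))

  rightNeighbour-cong : ∀ K s s′ u → (∀ a → u < a → a ≤ K → s a ≡ s′ a) → rightNeighbour K s u ≡ rightNeighbour K s′ u
  rightNeighbour-cong zero    s s′ u       same = refl
  rightNeighbour-cong (suc K) s s′ zero    same = same 1 (s≤s z≤n) (s≤s z≤n)
  rightNeighbour-cong (suc K) s s′ (suc u) same =
    rightNeighbour-cong K (λ a → s (suc a)) (λ a → s′ (suc a)) u (λ a u<a a≤K → same (suc a) (s≤s u<a) (s≤s a≤K))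

  neighbourSum : ℕ → (ℕ → ℕ) → ℕ → ℕ
  neighbourSum K y u = leftNeighbour y u + rightNeighbour K y u

  pathSum-raise : ∀ K (y y′ : ℕ → ℕ) u → u ≤ K → (∀ a → a ≤ K → a ≢ u → y′ a ≡ y a) → y u ≡ 0 → y′ u ≡ 1
                  → pathSum K y′ ≡ pathSum K y + neighbourSum K y u
  pathSum-raise zero y y′ .zero z≤n same y0 y′1 = refl
  pathSum-raise (suc K) y y′ zero _ same y0 y′1
    rewrite y0 | y′1 | same 1 (s≤s z≤n) (λ ())
          | sumN-cong K (λ a → y′ (suc a) * y′ (suc (suc a))) (λ a → y (suc a) * y (suc (suc a)))
              (λ i i< → cong₂ _*_ (same (suc i) (s≤s (<⇒≤ i<)) (λ ())) (same (suc (suc i)) (s≤s i<) (λ ())))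
    = regroup (y 1) (pathSum K (λ a → y (suc a)))
    where
    regroup : ∀ a s → a + 0 + s ≡ s + a
    regroup = solve-∀
  pathSum-raise (suc K) y y′ (suc zero) (s≤s u≤) same y0 y′1
    rewrite y0 | y′1 | same 0 z≤n (λ ())
          | pathSum-raise K (λ a → y (suc a)) (λ a → y′ (suc a)) zero z≤n
              (λ a a≤ a≢ → same (suc a) (s≤s a≤) (λ eq → a≢ (suc-injective eq))) y0 y′1
    = regroup (y 0) (pathSum K (λ a → y (suc a))) (rightNeighbour K (λ a → y (suc a)) zero)
    where
    regroup : ∀ a s n → a * 1 + (s + n) ≡ a * 0 + s + (a + n)
    regroup = solve-∀
  pathSum-raise (suc K) y y′ (suc (suc u)) (s≤s u≤) same y0 y′1
    rewrite same 0 z≤n (λ ()) | same 1 (s≤s z≤n) (λ ())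
          | pathSum-raise K (λ a → y (suc a)) (λ a → y′ (suc a)) (suc u) u≤
              (λ a a≤ a≢ → same (suc a) (s≤s a≤) (λ eq → a≢ (suc-injective eq))) y0 y′1
    = sym (+-assoc (y 0 * y 1) _ _)

module Pivots where

  open import Data.Nat using (ℕ; zero; suc; _≤_; _<_; z≤n; s≤s)
  open import Data.Nat.Properties
  open import Data.Bool using (Bool; true; false; if_then_else_)
  open import Data.Maybe using (Maybe; just; nothing; maybe)
  import Data.Maybe as Maybe
  open import Data.Sum using (_⊎_; inj₁; inj₂)
  open import Data.Product using (Σ-syntax; _×_; _,_)
  open import Data.Empty using (⊥-elim)
  open import Relation.Binary.PropositionalEquality

  lastFalse : (ℕ → Bool) → ℕ → Maybe ℕ
  lastFalse z zero    = nothing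
  lastFalse z (suc K) = if z K then lastFalse z K else just K

  lastFalse-cong : ∀ z z′ K → (∀ a → a < K → z a ≡ z′ a) → lastFalse z K ≡ lastFalse z′ K
  lastFalse-cong z z′ zero    eq = refl
  lastFalse-cong z z′ (suc K) eq rewrite eq K (n<1+n K) | lastFalse-cong z z′ K (λ a a< → eq a (m<n⇒m<1+n a<)) = refl

  true-above : ∀ (z : ℕ → Bool) {v K} → (∀ a → v < a → a < K → z a ≡ true) → z K ≡ true → ∀ a → v < a → a < suc K → z a ≡ true
  true-above z rest zK a v<a a<1+K with m≤n⇒m<n∨m≡n (≤-pred a<1+K)
  ... | inj₁ a<K  = rest a v<a a<K
  ... | inj₂ refl = zK

  lastFalse-just : ∀ z K v → lastFalse z K ≡ just v → v < K × z v ≡ false × (∀ a → v < a → a < K → z a ≡ true)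
  lastFalse-just z (suc K) v eq with z K in zK
  ... | false with eq
  ...   | refl = n<1+n K , zK , λ a v<a a<1+K → ⊥-elim (<⇒≱ v<a (≤-pred a<1+K))
  lastFalse-just z (suc K) v eq | true with lastFalse-just z K v eq
  ... | v<K , zv , rest = m<n⇒m<1+n v<K , zv , true-above z rest zK

  lastFalse-nothing : ∀ z K → lastFalse z K ≡ nothing → ∀ a → a < K → z a ≡ true
  lastFalse-nothing z (suc K) eq a a< with z K in zK
  lastFalse-nothing z (suc K) () a a< | false
  ... | true with m≤n⇒m<n∨m≡n (≤-pred a<)
  ...   | inj₁ a<K  = lastFalse-nothing z K eq a a<K
  ...   | inj₂ refl = zK

  module _ (n : ℕ) where

    AfterLastFalse : (ℕ → Bool) → ℕ → Set
    AfterLastFalse z u = Σ[ v ∈ ℕ ] u ≡ suc v × v < suc n × z v ≡ false × (∀ a → v < a → a ≤ suc n → z a ≡ true)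

    -- The pairing toggles the path variable just after the last disagreement of the two indices; for pairs
    -- across quadrants 1 and 2 it also pairs indices that agree everywhere, at position 0.
    pivotSame : (ℕ → Bool) → Maybe ℕ
    pivotSame z = if z (suc n) then Maybe.map suc (lastFalse z (suc n)) else nothing

    pivotCross : (ℕ → Bool) → Maybe ℕ
    pivotCross z = if z (suc n) then just (maybe suc 0 (lastFalse z (suc n))) else nothing

    pivotSame-cong : ∀ z z′ → (∀ a → a ≤ suc n → z a ≡ z′ a) → pivotSame z ≡ pivotSame z′
    pivotSame-cong z z′ eq rewrite eq (suc n) ≤-refl | lastFalse-cong z z′ (suc n) (λ a a< → eq a (<⇒≤ a<)) = refl

    pivotCross-cong : ∀ z z′ → (∀ a → a ≤ suc n → z a ≡ z′ a) → pivotCross z ≡ pivotCross z′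
    pivotCross-cong z z′ eq rewrite eq (suc n) ≤-refl | lastFalse-cong z z′ (suc n) (λ a a< → eq a (<⇒≤ a<)) = refl

    private
      after-lastFalse : ∀ z v → z (suc n) ≡ true → lastFalse z (suc n) ≡ just v → AfterLastFalse z (suc v)
      after-lastFalse z v zn eq with lastFalse-just z (suc n) v eq
      ... | v< , zv , rest = v , refl , v< , zv , λ a v<a a≤ → true-above z rest zn a v<a (s≤s a≤)

      all-true : ∀ z → z (suc n) ≡ true → lastFalse z (suc n) ≡ nothing → ∀ a → a ≤ suc n → z a ≡ true
      all-true z zn eq a a≤ with m≤n⇒m<n∨m≡n a≤
      ... | inj₁ a<  = lastFalse-nothing z (suc n) eq a a<
      ... | inj₂ refl = zn

    pivotSame-just : ∀ z u → pivotSame z ≡ just u → AfterLastFalse z u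
    pivotSame-just z u eq with z (suc n) in zn
    pivotSame-just z u () | false
    ... | true with lastFalse z (suc n) in lf
    pivotSame-just z u ()   | true | nothing
    pivotSame-just z u refl | true | just v = after-lastFalse z v zn lf

    pivotSame-nothing : ∀ z → pivotSame z ≡ nothing → z (suc n) ≡ false ⊎ (∀ a → a ≤ suc n → z a ≡ true)
    pivotSame-nothing z eq with z (suc n) in zn
    ... | false = inj₁ refl
    ... | true with lastFalse z (suc n) in lf
    ...   | nothing = inj₂ (all-true z zn lf)
    pivotSame-nothing z () | true | just _

    pivotCross-just : ∀ z u → pivotCross z ≡ just u
                      → z (suc n) ≡ true × ((u ≡ 0 × (∀ a → a ≤ suc n → z a ≡ true)) ⊎ AfterLastFalse z u)
    pivotCross-just z u eq with z (suc n) in zn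
    pivotCross-just z u () | false
    ... | true with lastFalse z (suc n) in lf
    pivotCross-just z u refl | true | nothing = refl , inj₁ (refl , all-true z zn lf)
    pivotCross-just z u refl | true | just v  = refl , inj₂ (after-lastFalse z v zn lf)

    pivotCross-nothing : ∀ z → pivotCross z ≡ nothing → z (suc n) ≡ false
    pivotCross-nothing z eq with z (suc n)
    ... | false = refl
    pivotCross-nothing z () | true

    afterLastFalse-true : ∀ z u → AfterLastFalse z u → u ≤ suc n × z u ≡ true
    afterLastFalse-true z .(suc v) (v , refl , v< , _ , rest) = v< , rest (suc v) ≤-refl v<

    pivotSame-true : ∀ z u → pivotSame z ≡ just u → u ≤ suc n × z u ≡ true
    pivotSame-true z u eq = afterLastFalse-true z u (pivotSame-just z u eq)

    pivotCross-true : ∀ z u → pivotCross z ≡ just u → u ≤ suc n × z u ≡ true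
    pivotCross-true z u eq with pivotCross-just z u eq
    ... | _ , inj₁ (refl , all) = z≤n , all 0 z≤n
    ... | _ , inj₂ after        = afterLastFalse-true z u after

module Paths where

  open import Defs
  open Binary
  open NatSums
  open import Data.Nat using (ℕ; suc; _+_; _*_; _^_; _≤_; _<_; s≤s; _≡ᵇ_; _≟_)
  open import Data.Nat.Properties using (≡ᵇ⇒≡; ≡⇒≡ᵇ; ≤-pred)
  open import Data.Bool using (Bool; true; false; T)
  open import Data.Fin using (toℕ; fromℕ<; inject₁; fromℕ) renaming (suc to fsuc)
  import Data.Fin.Properties as Fin
  open import Data.Fin.Permutation using (Permutation′; _⟨$⟩ʳ_; _⟨$⟩ˡ_; inverseˡ; inverseʳ)
  open import Data.Product using (Σ-syntax; _×_; _,_)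
  open import Relation.Binary.PropositionalEquality hiding (J)
  open import Relation.Nullary using (yes; no)

  -- Position a of the path x_{π(0)} x_{π(1)} ⋯ x_{π(n+1)} carries the variable x_{p a}.
  module Path (n : ℕ) (π : Permutation′ (suc (suc n))) where

    r : ℕ
    r = suc (suc n)

    p : ℕ → ℕ
    p = extend (λ x → toℕ (π ⟨$⟩ʳ x))

    p-toℕ : ∀ x → p (toℕ x) ≡ toℕ (π ⟨$⟩ʳ x)
    p-toℕ = extend-toℕ (λ x → toℕ (π ⟨$⟩ʳ x))

    private
      p≡π : ∀ {a} (a< : a < r) → p a ≡ toℕ (π ⟨$⟩ʳ fromℕ< a<)
      p≡π a< = trans (cong p (sym (Fin.toℕ-fromℕ< a<))) (p-toℕ (fromℕ< a<))

    p-< : ∀ a → a < r → p a < r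
    p-< a a< = subst (_< r) (sym (p≡π a<)) (Fin.toℕ<n _)

    p-injective : ∀ a b → a < r → b < r → p a ≡ p b → a ≡ b
    p-injective a b a< b< pa≡pb = begin
      a                  ≡⟨ Fin.toℕ-fromℕ< a< ⟨
      toℕ (fromℕ< a<)    ≡⟨ cong toℕ same-preimage ⟩
      toℕ (fromℕ< b<)    ≡⟨ Fin.toℕ-fromℕ< b< ⟩
      b                  ∎
      where
      open ≡-Reasoning
      same-preimage : fromℕ< a< ≡ fromℕ< b<
      same-preimage = trans (sym (inverseˡ π))
        (trans (cong (π ⟨$⟩ˡ_) (Fin.toℕ-injective (trans (sym (p≡π a<)) (trans pa≡pb (p≡π b<))))) (inverseˡ π))

    p-surjective : ∀ c → c < r → Σ[ a ∈ ℕ ] a < r × p a ≡ c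
    p-surjective c c< = toℕ (π ⟨$⟩ˡ fromℕ< c<) , Fin.toℕ<n _ ,
      trans (p-toℕ _) (trans (cong toℕ (inverseʳ π)) (Fin.toℕ-fromℕ< c<))

    y : ℕ → ℕ → ℕ
    y i a = bit i (p a)

    yLast : ℕ → ℕ
    yLast i = y i (suc n)

    Q Q̄ : ℕ → ℕ
    Q i = pathSum (suc n) (y i)
    Q̄ i = pathSum (suc n) (λ a → bar (y i a))

    private
      p-inject₁ : ∀ α → p (toℕ α) ≡ toℕ (π ⟨$⟩ʳ inject₁ α)
      p-inject₁ α = trans (cong p (sym (Fin.toℕ-inject₁ α))) (p-toℕ (inject₁ α))

      p-last : p (suc n) ≡ toℕ (π ⟨$⟩ʳ fromℕ (suc n))
      p-last = trans (cong p (sym (Fin.toℕ-fromℕ (suc n)))) (p-toℕ (fromℕ (suc n)))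

    ζ≡Q : ∀ d i → ζ n π d i ≡ Q i + d * yLast i
    ζ≡Q d i = cong₂ _+_
      (sumF≡sumN (suc n) _ (λ a → y i a * y i (suc a))
         (λ α → cong₂ _*_ (cong (bit i) (sym (p-inject₁ α))) (cong (bit i) (sym (p-toℕ (fsuc α))))))
      (cong (λ z → d * bit i z) (sym p-last))

    η≡Q̄ : ∀ d i → η n π d i ≡ Q̄ i + bar d * yLast i
    η≡Q̄ d i = cong₂ _+_
      (sumF≡sumN (suc n) _ (λ a → bar (y i a) * bar (y i (suc a)))
         (λ α → cong₂ _*_ (cong (λ z → bar (bit i z)) (sym (p-inject₁ α))) (cong (λ z → bar (bit i z)) (sym (p-toℕ (fsuc α))))))
      (cong (λ z → bar d * bit i z) (sym p-last))

    agree : ℕ → ℕ → ℕ → Bool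
    agree j j′ a = y j a ≡ᵇ y j′ a

    agree⇒ : ∀ j j′ a → agree j j′ a ≡ true → y j a ≡ y j′ a
    agree⇒ j j′ a eq = ≡ᵇ⇒≡ _ _ (subst T (sym eq) _)

    agree⇐ : ∀ j j′ a → y j a ≡ y j′ a → agree j j′ a ≡ true
    agree⇐ j j′ a eq with agree j j′ a | ≡⇒≡ᵇ (y j a) (y j′ a) eq
    ... | true | _ = refl

    disagree⇒ : ∀ j j′ a → agree j j′ a ≡ false → y j a ≢ y j′ a
    disagree⇒ j j′ a eq y≡ with trans (sym eq) (agree⇐ j j′ a y≡)
    ... | ()

    module Raise (j u : ℕ) (u≤ : u ≤ suc n) (yu≡0 : y j u ≡ 0) where

      J : ℕ
      J = j + 2 ^ p u

      J-< : j < 2 ^ r → J < 2 ^ r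
      J-< j< = +2^-< r j (p u) j< (p-< u (s≤s u≤)) yu≡0

      y-at : y J u ≡ 1
      y-at = bit-+2^-at j (p u) yu≡0

      y-elsewhere : ∀ a → a ≤ suc n → a ≢ u → y J a ≡ y j a
      y-elsewhere a a≤ a≢u = bit-+2^-elsewhere j (p u) yu≡0 (p a) (λ eq → a≢u (p-injective a u (s≤s a≤) (s≤s u≤) eq))

      Q-raise : Q J ≡ Q j + neighbourSum (suc n) (y j) u
      Q-raise = pathSum-raise (suc n) (y j) (y J) u u≤ y-elsewhere yu≡0 y-at

      Q̄-raise : Q̄ j ≡ Q̄ J + neighbourSum (suc n) (λ a → bar (y J a)) u
      Q̄-raise = pathSum-raise (suc n) (λ a → bar (y J a)) (λ a → bar (y j a)) u u≤
                  (λ a a≤ a≢u → cong bar (sym (y-elsewhere a a≤ a≢u))) (cong bar y-at) (cong bar yu≡0)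

    agree-raise : ∀ j j′ u (u≤ : u ≤ suc n) (yu≡0 : y j u ≡ 0) (y′u≡0 : y j′ u ≡ 0)
                  → ∀ a → a ≤ suc n → agree (Raise.J j u u≤ yu≡0) (Raise.J j′ u u≤ y′u≡0) a ≡ agree j j′ a
    agree-raise j j′ u u≤ yu≡0 y′u≡0 a a≤ with a ≟ u
    ... | yes refl = trans (cong₂ _≡ᵇ_ (Raise.y-at j u u≤ yu≡0) (Raise.y-at j′ u u≤ y′u≡0)) (sym (agree⇐ j j′ u (trans yu≡0 (sym y′u≡0))))
    ... | no a≢u  = cong₂ _≡ᵇ_ (Raise.y-elsewhere j u u≤ yu≡0 a a≤ a≢u) (Raise.y-elsewhere j′ u u≤ y′u≡0 a a≤ a≢u)

    agree-everywhere : ∀ j j′ → j < 2 ^ r → j′ < 2 ^ r → (∀ a → a ≤ suc n → agree j j′ a ≡ true) → j ≡ j′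
    agree-everywhere j j′ j< j′< all = bits-injective r j j′ j< j′< λ c c< → same-bit c (p-surjective c c<)
      where
      same-bit : ∀ c → Σ[ a ∈ ℕ ] a < r × p a ≡ c → bit j c ≡ bit j′ c
      same-bit c (a , a< , refl) = agree⇒ j j′ a (all a (≤-pred a<))

module RingLemmas where

  open import Defs
  open import Level using (Level)
  open import Algebra.Bundles using (CommutativeRing)
  open import Data.Nat using (ℕ; zero; suc) renaming (_+_ to _+ℕ_; _*_ to _*ℕ_; _∸_ to _∸ℕ_; _<_ to _<ℕ_)
  import Data.Nat.Properties as ℕ
  open import Data.Fin using (Fin; toℕ; fromℕ<; inject₁; fromℕ)
  import Data.Fin.Properties as Fin
  open import Data.Fin.Permutation using (permutation)
  open import Data.Sum using (inj₁; inj₂)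
  open import Data.Product using (proj₂)
  open import Data.Empty using (⊥-elim)
  open import Data.Maybe using (nothing)
  open import Relation.Binary.PropositionalEquality as ≡ using (_≡_)
  open import Tactic.RingSolver using (solve-∀)
  open import Tactic.RingSolver.Core.AlmostCommutativeRing using (AlmostCommutativeRing; fromCommutativeRing)
  open import Relation.Nullary using (¬_)
  import Data.Nat.Tactic.RingSolver as ℕ-Solver

  module _ {ℓ₁ ℓ₂ : Level} (R : CommutativeRing ℓ₁ ℓ₂) where
    ACR : AlmostCommutativeRing ℓ₁ ℓ₂
    ACR = fromCommutativeRing R (λ _ → nothing)
    open AlmostCommutativeRing ACR
    open import Relation.Binary.Reasoning.Setoid setoid
    open import Algebra.Properties.CommutativeMonoid.Sum (CommutativeRing.+-commutativeMonoid R)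
      using (sum-permute; ∑-distrib-+)
    open import Algebra.Properties.Monoid.Sum (CommutativeRing.+-monoid R)
      using (sum; sum-init-last; sum-cong-≋; sum-replicate-zero)

    pow-+ : ∀ x a b → pow R x (a +ℕ b) ≈ pow R x a * pow R x b
    pow-+ x zero    b = sym (*-identityˡ _)
    pow-+ x (suc a) b = trans (*-congˡ (pow-+ x a b)) (sym (*-assoc _ _ _))

    pow-* : ∀ x a b → pow R x (a *ℕ b) ≈ pow R (pow R x a) b
    pow-* x a zero    = reflexive (≡.cong (pow R x) (ℕ.*-zeroʳ a))
    pow-* x a (suc b) = begin
      pow R x (a *ℕ suc b)             ≡⟨ ≡.cong (pow R x) (ℕ.*-suc a b) ⟩
      pow R x (a +ℕ a *ℕ b)            ≈⟨ pow-+ x a (a *ℕ b) ⟩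
      pow R x a * pow R x (a *ℕ b)     ≈⟨ *-congˡ (pow-* x a b) ⟩
      pow R x a * pow R (pow R x a) b  ∎

    pow-1# : ∀ a → pow R 1# a ≈ 1#
    pow-1# zero    = refl
    pow-1# (suc a) = trans (*-identityˡ _) (pow-1# a)

    pow-cong : ∀ {x y} a → x ≈ y → pow R x a ≈ pow R y a
    pow-cong zero    x≈y = refl
    pow-cong (suc a) x≈y = *-cong x≈y (pow-cong a x≈y)

    sumR-cong : ∀ K (h h′ : ℕ → Carrier) → (∀ t → t <ℕ K → h t ≈ h′ t) → sumR R K h ≈ sumR R K h′
    sumR-cong zero    h h′ eq = refl
    sumR-cong (suc K) h h′ eq = +-cong (sumR-cong K h h′ (λ t t< → eq t (ℕ.m<n⇒m<1+n t<))) (eq K (ℕ.n<1+n K))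

    sumR-+ : ∀ K (h h′ : ℕ → Carrier) → sumR R K h + sumR R K h′ ≈ sumR R K (λ t → h t + h′ t)
    sumR-+ zero    h h′ = +-identityˡ _
    sumR-+ (suc K) h h′ = trans (interchange _ _ _ _) (+-cong (sumR-+ K h h′) refl)
      where
      interchange : ∀ a b c d → (a + b) + (c + d) ≈ (a + c) + (b + d)
      interchange = solve-∀ ACR

    sumR-split : ∀ a b (h : ℕ → Carrier) → sumR R (a +ℕ b) h ≈ sumR R a h + sumR R b (λ t → h (a +ℕ t))
    sumR-split a zero    h = trans (reflexive (≡.cong (λ z → sumR R z h) (ℕ.+-identityʳ a))) (sym (+-identityʳ _))
    sumR-split a (suc b) h = begin
      sumR R (a +ℕ suc b) h                                         ≡⟨ ≡.cong (λ z → sumR R z h) (ℕ.+-suc a b) ⟩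
      sumR R (a +ℕ b) h + h (a +ℕ b)                                ≈⟨ +-congʳ (sumR-split a b h) ⟩
      (sumR R a h + sumR R b (λ t → h (a +ℕ t))) + h (a +ℕ b)       ≈⟨ +-assoc _ _ _ ⟩
      sumR R a h + sumR R (suc b) (λ t → h (a +ℕ t))                ∎

    sumR-1 : ∀ (h : ℕ → Carrier) → sumR R 1 h ≈ h 0
    sumR-1 h = +-identityˡ _

    sumR-cons : ∀ a (h : ℕ → Carrier) → sumR R (1 +ℕ a) h ≈ h 0 + sumR R a (λ t → h (suc t))
    sumR-cons a h = trans (sumR-split 1 a h) (+-congʳ (sumR-1 h))

    sumR-snoc : ∀ a (h : ℕ → Carrier) → sumR R (a +ℕ 1) h ≈ sumR R a h + h (a +ℕ 0)
    sumR-snoc a h = trans (sumR-split a 1 h) (+-congˡ (sumR-1 (λ t → h (a +ℕ t))))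

    sumR≈sum : ∀ K (h : ℕ → Carrier) → sumR R K h ≈ sum {K} (λ i → h (toℕ i))
    sumR≈sum zero    h = refl
    sumR≈sum (suc K) h = sym (begin
      sum {suc K} (λ i → h (toℕ i))                              ≈⟨ sum-init-last (λ i → h (toℕ i)) ⟩
      sum {K} (λ i → h (toℕ (inject₁ i))) + h (toℕ (fromℕ K))    ≈⟨ +-cong (sum-cong-≋ {K} (λ i → reflexive (≡.cong h (Fin.toℕ-inject₁ i))))
                                                                             (reflexive (≡.cong h (Fin.toℕ-fromℕ K))) ⟩
      sum {K} (λ i → h (toℕ i)) + h K                            ≈⟨ +-congʳ (sumR≈sum K h) ⟨
      sumR R (suc K) h                                           ∎)

    module _ (dom : IsIntegralDomain R) (char0 : CharZero R) where

      x+x≈0⇒x≈0 : ∀ x → x + x ≈ 0# → x ≈ 0#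
      x+x≈0⇒x≈0 x x+x≈0 with proj₂ dom (1# + 1#) x (trans two*x≈x+x x+x≈0)
        where
        two*x≈x+x : (1# + 1#) * x ≈ x + x
        two*x≈x+x = trans (distribʳ x 1# 1#) (+-cong (*-identityˡ x) (*-identityˡ x))
      ... | inj₂ x≈0 = x≈0
      ... | inj₁ 2≈0 = ⊥-elim (char0 1 (trans (+-congˡ (+-identityʳ 1#)) 2≈0))

      -- Fixed points t = σ t are covered too: h t + h t ≈ 0 forces h t ≈ 0 in characteristic 0.
      sumR-involution : ∀ K (h : ℕ → Carrier) (σ : ℕ → ℕ) → (∀ t → t <ℕ K → σ t <ℕ K) → (∀ t → t <ℕ K → σ (σ t) ≡ t)
                        → (∀ t → t <ℕ K → h (σ t) + h t ≈ 0#) → sumR R K h ≈ 0#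
      sumR-involution K h σ σ< σσ≡id cancels = trans (sumR≈sum K h) (x+x≈0⇒x≈0 _ (begin
        sum f + sum f                  ≈⟨ +-congʳ (sum-permute f σ-perm) ⟩
        sum (λ i → f (σF i)) + sum f   ≈⟨ ∑-distrib-+ (λ i → f (σF i)) f ⟨
        sum (λ i → f (σF i) + f i)     ≈⟨ sum-cong-≋ (λ i → trans (reflexive (≡.cong (λ z → h z + f i) (Fin.toℕ-fromℕ< _)))
                                                                  (cancels (toℕ i) (Fin.toℕ<n i))) ⟩
        sum {K} (λ _ → 0#)             ≈⟨ sum-replicate-zero K ⟩
        0#                             ∎))
        where
        f : Fin K → Carrier
        f i = h (toℕ i)
        σF : Fin K → Fin K
        σF i = fromℕ< (σ< (toℕ i) (Fin.toℕ<n i))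
        σF-involutive : ∀ i → σF (σF i) ≡ i
        σF-involutive i = Fin.toℕ-injective
          (≡.trans (Fin.toℕ-fromℕ< _) (≡.trans (≡.cong σ (Fin.toℕ-fromℕ< _)) (σσ≡id (toℕ i) (Fin.toℕ<n i))))
        σ-perm = permutation σF σF σF-involutive σF-involutive

  -- The even modulus is written q = 2h with h = suc k, so that q ∸ 1 is a true predecessor.
  module Signs {ℓ₁ ℓ₂ : Level} (R : CommutativeRing ℓ₁ ℓ₂) (dom : IsIntegralDomain R)
               (k : ℕ) (ω : CommutativeRing.Carrier R)
               (ω^q≈1 : CommutativeRing._≈_ R (pow R ω (suc k *ℕ 2)) (CommutativeRing.1# R))
               (ω^h≉1 : ¬ CommutativeRing._≈_ R (pow R ω (suc k)) (CommutativeRing.1# R)) where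
    private
      ring : AlmostCommutativeRing ℓ₁ ℓ₂
      ring = ACR R
    open AlmostCommutativeRing ring
    open import Relation.Binary.Reasoning.Setoid setoid
    open import Algebra.Properties.Ring (CommutativeRing.ring R) using (-‿distribˡ-*)
    open CommutativeRing R using (-‿inverseˡ; -‿inverseʳ)

    h q : ℕ
    h = suc k
    q = h *ℕ 2

    Ω : ℕ → Carrier
    Ω = pow R ω

    ν : Carrier
    ν = Ω h

    ν^ : ℕ → Carrier
    ν^ = pow R ν

    Ω-q* : ∀ a → Ω (q *ℕ a) ≈ 1#
    Ω-q* a = trans (pow-* R ω q a) (trans (pow-cong R a ω^q≈1) (pow-1# R a))

    ν*ν≈1 : ν * ν ≈ 1#
    ν*ν≈1 = trans (sym (pow-+ R ω h h)) (trans (reflexive (≡.cong Ω h+h≡q)) ω^q≈1)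
      where
      h+h≡q : h +ℕ h ≡ q
      h+h≡q = ≡.trans (≡.cong (h +ℕ_) (≡.sym (ℕ.+-identityʳ h))) (ℕ.*-comm 2 h)

    -- ν is a root of (X - 1)(X + 1) other than 1, hence ν = -1 in a domain.
    ν+1≈0 : ν + 1# ≈ 0#
    ν+1≈0 with proj₂ dom (ν + - 1#) (ν + 1#) factored
      where
      factored : (ν + - 1#) * (ν + 1#) ≈ 0#
      factored = begin
        (ν + - 1#) * (ν + 1#)                    ≈⟨ distribʳ _ _ _ ⟩
        ν * (ν + 1#) + (- 1#) * (ν + 1#)         ≈⟨ +-cong (distribˡ _ _ _) (sym (-‿distribˡ-* 1# (ν + 1#))) ⟩
        (ν * ν + ν * 1#) + - (1# * (ν + 1#))     ≈⟨ +-cong (+-cong ν*ν≈1 (*-identityʳ ν)) (-‿cong (*-identityˡ _)) ⟩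
        (1# + ν) + - (ν + 1#)                    ≈⟨ +-congʳ (+-comm _ _) ⟩
        (ν + 1#) + - (ν + 1#)                    ≈⟨ -‿inverseʳ _ ⟩
        0#                                       ∎
    ... | inj₂ ν+1≈0 = ν+1≈0
    ... | inj₁ ν-1≈0 = ⊥-elim (ω^h≉1 (begin
      ν                   ≈⟨ +-identityʳ ν ⟨
      ν + 0#              ≈⟨ +-congˡ (-‿inverseˡ 1#) ⟨
      ν + (- 1# + 1#)     ≈⟨ +-assoc _ _ _ ⟨
      (ν + - 1#) + 1#     ≈⟨ +-congʳ ν-1≈0 ⟩
      0# + 1#             ≈⟨ +-identityˡ _ ⟩
      1#                  ∎))

    ν^-2* : ∀ x → ν^ (2 *ℕ x) ≈ 1#
    ν^-2* x = trans (pow-* R ν 2 x) (trans (pow-cong R x (trans (*-congˡ (*-identityʳ ν)) ν*ν≈1)) (pow-1# R x))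

    ν^-mod2 : ∀ a b x y → a +ℕ 2 *ℕ x ≡ b +ℕ 2 *ℕ y → ν^ a ≈ ν^ b
    ν^-mod2 a b x y eq = begin
      ν^ a                    ≈⟨ *-identityʳ _ ⟨
      ν^ a * 1#               ≈⟨ *-congˡ (ν^-2* x) ⟨
      ν^ a * ν^ (2 *ℕ x)      ≈⟨ pow-+ R ν a _ ⟨
      ν^ (a +ℕ 2 *ℕ x)        ≡⟨ ≡.cong ν^ eq ⟩
      ν^ (b +ℕ 2 *ℕ y)        ≈⟨ pow-+ R ν b _ ⟩
      ν^ b * ν^ (2 *ℕ y)      ≈⟨ *-congˡ (ν^-2* y) ⟩
      ν^ b * 1#               ≈⟨ *-identityʳ _ ⟩
      ν^ b                    ∎

    ν^-flip : ∀ a a′ b b′ x y → a +ℕ a′ +ℕ 2 *ℕ x ≡ suc (b +ℕ b′) +ℕ 2 *ℕ y → ν^ a * ν^ a′ ≈ ν * (ν^ b * ν^ b′)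
    ν^-flip a a′ b b′ x y eq = begin
      ν^ a * ν^ a′          ≈⟨ pow-+ R ν a a′ ⟨
      ν^ (a +ℕ a′)          ≈⟨ ν^-mod2 (a +ℕ a′) (suc (b +ℕ b′)) x y eq ⟩
      ν * ν^ (b +ℕ b′)      ≈⟨ *-congˡ (pow-+ R ν b b′) ⟩
      ν * (ν^ b * ν^ b′)    ∎

    ν*-swap : ∀ a b → a ≈ ν * b → b ≈ ν * a
    ν*-swap a b a≈νb = begin
      b              ≈⟨ *-identityˡ b ⟨
      1# * b         ≈⟨ *-congʳ ν*ν≈1 ⟨
      (ν * ν) * b    ≈⟨ *-assoc ν ν b ⟩
      ν * (ν * b)    ≈⟨ *-congˡ a≈νb ⟨
      ν * a          ∎

    -- ω^x · conj(ω^y), with conj(ω^y) = ω^((q-1)y) as in the definition of ρ.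
    Ωdiff : ℕ → ℕ → Carrier
    Ωdiff x y = Ω x * Ω ((q ∸ℕ 1) *ℕ y)

    Ω*conj≈1 : ∀ a → Ω a * Ω ((q ∸ℕ 1) *ℕ a) ≈ 1#
    Ω*conj≈1 a = trans (sym (pow-+ R ω a _)) (Ω-q* a)

    Ωdiff-cong : ∀ x y x′ y′ → x +ℕ y′ ≡ x′ +ℕ y → Ωdiff x y ≈ Ωdiff x′ y′
    Ωdiff-cong x y x′ y′ eq = begin
      Ω x * Ω̄ y                          ≈⟨ *-identityʳ _ ⟨
      (Ω x * Ω̄ y) * 1#                   ≈⟨ *-congˡ (Ω*conj≈1 y′) ⟨
      (Ω x * Ω̄ y) * (Ω y′ * Ω̄ y′)        ≈⟨ regroup _ _ _ _ ⟩
      (Ω x * Ω y′) * (Ω̄ y * Ω̄ y′)        ≈⟨ *-congʳ (pow-+ R ω x y′) ⟨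
      Ω (x +ℕ y′) * (Ω̄ y * Ω̄ y′)         ≡⟨ ≡.cong (λ z → Ω z * (Ω̄ y * Ω̄ y′)) eq ⟩
      Ω (x′ +ℕ y) * (Ω̄ y * Ω̄ y′)         ≈⟨ *-congʳ (pow-+ R ω x′ y) ⟩
      (Ω x′ * Ω y) * (Ω̄ y * Ω̄ y′)        ≈⟨ swap _ _ _ _ ⟩
      (Ω x′ * Ω̄ y′) * (Ω̄ y * Ω y)        ≈⟨ *-congˡ (trans (*-comm _ _) (Ω*conj≈1 y)) ⟩
      (Ω x′ * Ω̄ y′) * 1#                 ≈⟨ *-identityʳ _ ⟩
      Ω x′ * Ω̄ y′                        ∎
      where
      Ω̄ : ℕ → Carrier
      Ω̄ z = Ω ((q ∸ℕ 1) *ℕ z)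
      regroup : ∀ a b c d → (a * c) * (b * d) ≈ (a * b) * (c * d)
      regroup = solve-∀ ring
      swap : ∀ a b c d → (a * b) * (c * d) ≈ (a * d) * (c * b)
      swap = solve-∀ ring

    Ωdiff-split : ∀ P L P′ L′ → Ωdiff (h *ℕ P +ℕ L) (h *ℕ P′ +ℕ L′) ≈ (ν^ P * ν^ P′) * Ωdiff L L′
    Ωdiff-split P L P′ L′ = begin
      Ω (h *ℕ P +ℕ L) * Ω (q-1 *ℕ (h *ℕ P′ +ℕ L′))                      ≡⟨ ≡.cong (λ z → Ω (h *ℕ P +ℕ L) * Ω z) (distribute k P′ L′) ⟩
      Ω (h *ℕ P +ℕ L) * Ω (h *ℕ (q-1 *ℕ P′) +ℕ q-1 *ℕ L′)               ≈⟨ *-cong (pow-+ R ω (h *ℕ P) L) (pow-+ R ω (h *ℕ (q-1 *ℕ P′)) (q-1 *ℕ L′)) ⟩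
      (Ω (h *ℕ P) * Ω L) * (Ω (h *ℕ (q-1 *ℕ P′)) * Ω (q-1 *ℕ L′))       ≈⟨ *-cong (*-congʳ (pow-* R ω h P)) (*-congʳ (trans (pow-* R ω h (q-1 *ℕ P′)) odd-power)) ⟩
      (ν^ P * Ω L) * (ν^ P′ * Ω (q-1 *ℕ L′))                             ≈⟨ regroup _ _ _ _ ⟩
      (ν^ P * ν^ P′) * Ωdiff L L′                                        ∎
      where
      q-1 = q ∸ℕ 1
      distribute : ∀ k P L → suc (k *ℕ 2) *ℕ (suc k *ℕ P +ℕ L) ≡ suc k *ℕ (suc (k *ℕ 2) *ℕ P) +ℕ suc (k *ℕ 2) *ℕ L
      distribute = ℕ-Solver.solve-∀
      odd-multiple : ∀ k P → suc (k *ℕ 2) *ℕ P +ℕ 2 *ℕ 0 ≡ P +ℕ 2 *ℕ (k *ℕ P)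
      odd-multiple = ℕ-Solver.solve-∀
      odd-power : ν^ (q-1 *ℕ P′) ≈ ν^ P′
      odd-power = ν^-mod2 (q-1 *ℕ P′) P′ 0 (k *ℕ P′) (odd-multiple k P′)
      regroup : ∀ a b c d → (a * b) * (c * d) ≈ (a * c) * (b * d)
      regroup = solve-∀ ring

    cancel-pair : ∀ S₀ S₁ S₀′ S₁′ w w′ → S₀′ ≈ ν * S₀ → S₁′ ≈ ν * S₁ → w′ ≈ w → (S₀′ + S₁′) * w′ + (S₀ + S₁) * w ≈ 0#
    cancel-pair S₀ S₁ S₀′ S₁′ w w′ e₀ e₁ ew = begin
      (S₀′ + S₁′) * w′ + (S₀ + S₁) * w                 ≈⟨ +-congʳ (*-cong (+-cong e₀ e₁) ew) ⟩
      (ν * S₀ + ν * S₁) * w + (S₀ + S₁) * w            ≈⟨ +-congʳ (trans (*-congʳ (sym (distribˡ ν S₀ S₁))) (*-assoc _ _ _)) ⟩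
      ν * ((S₀ + S₁) * w) + (S₀ + S₁) * w              ≈⟨ +-congˡ (*-identityˡ _) ⟨
      ν * ((S₀ + S₁) * w) + 1# * ((S₀ + S₁) * w)       ≈⟨ distribʳ _ _ _ ⟨
      (ν + 1#) * ((S₀ + S₁) * w)                       ≈⟨ *-congʳ ν+1≈0 ⟩
      0# * ((S₀ + S₁) * w)                             ≈⟨ zeroˡ _ ⟩
      0#                                               ∎

    cancel-self : ∀ S₀ S₁ w → S₁ ≈ ν * S₀ → (S₀ + S₁) * w ≈ 0#
    cancel-self S₀ S₁ w e = begin
      (S₀ + S₁) * w               ≈⟨ *-congʳ (+-cong (sym (*-identityˡ S₀)) e) ⟩
      (1# * S₀ + ν * S₀) * w      ≈⟨ *-congʳ (distribʳ _ _ _) ⟨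
      ((1# + ν) * S₀) * w         ≈⟨ *-congʳ (*-congʳ (trans (+-comm _ _) ν+1≈0)) ⟩
      (0# * S₀) * w               ≈⟨ *-congʳ (zeroˡ _) ⟩
      0# * w                      ≈⟨ zeroˡ _ ⟩
      0#                          ∎

module PivotPairing where

  open import Defs
  open Binary
  open Paths
  open RingLemmas
  open import Level using (Level)
  open import Algebra.Bundles using (CommutativeRing)
  open import Data.Nat using (ℕ; zero; suc; _+_; _∸_; _^_; _≤_; _<_)
  open import Data.Nat.Properties
  open import Data.Fin.Permutation using (Permutation′)
  open import Data.Bool using (Bool; true)
  open import Data.Maybe using (Maybe; just; nothing; maybe)
  open import Data.Sum using (_⊎_; inj₁; inj₂)
  open import Data.Product using (Σ-syntax; _×_; _,_; proj₁; proj₂)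
  open import Relation.Binary.PropositionalEquality hiding (J)
  open import Algebra.Properties.CommutativeSemigroup +-commutativeSemigroup using (xy∙z≈xz∙y)

  offsets-< : ∀ {t K D₁ D₂ N} → t < K → K + D₁ + D₂ ≡ N → t + D₁ < N × t + D₂ < N
  offsets-< {t} {K} {D₁} {D₂} {N} t< K+D₁+D₂≡N =
    ≤-<-trans (m≤m+n (t + D₁) D₂) all< , ≤-<-trans (subst (t + D₂ ≤_) (xy∙z≈xz∙y t D₂ D₁) (m≤m+n (t + D₂) D₁)) all<
    where
    all< : t + D₁ + D₂ < N
    all< = subst (t + D₁ + D₂ <_) K+D₁+D₂≡N (+-monoˡ-< D₂ (+-monoˡ-< D₁ t<))

  module _ {ℓ₁ ℓ₂ : Level} (R : CommutativeRing ℓ₁ ℓ₂) (dom : IsIntegralDomain R) (char0 : CharZero R)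
           (n : ℕ) (π : Permutation′ (suc (suc n))) where

    open Path n π
    open CommutativeRing R using (Carrier; _≈_; 0#)
      renaming (_+_ to _⊕_; +-cong to ⊕-cong; +-comm to ⊕-comm; +-identityˡ to ⊕-identityˡ; trans to ≈-trans; refl to ≈-refl; reflexive to ≈-reflexive)

    -- The terms F (t + D₁) (t + D₂), t < K, pair off in opposite signs under toggling the bit at the pivot.
    module PivotInvolution
        (pivot : (ℕ → Bool) → Maybe ℕ)
        (pivot-cong : ∀ z z′ → (∀ a → a ≤ suc n → z a ≡ z′ a) → pivot z ≡ pivot z′)
        (pivot-true : ∀ z u → pivot z ≡ just u → u ≤ suc n × z u ≡ true)
        (F : ℕ → ℕ → Carrier) (K D₁ D₂ : ℕ) (D₁≡0⊎D₂≡0 : D₁ ≡ 0 ⊎ D₂ ≡ 0) (K+D₁+D₂≡2^r : K + D₁ + D₂ ≡ 2 ^ r)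
        (unpaired : ∀ t → t < K → pivot (agree (t + D₁) (t + D₂)) ≡ nothing → F (t + D₁) (t + D₂) ≈ 0#)
        (paired : ∀ j j′ u (u≤ : u ≤ suc n) (yu≡0 : y j u ≡ 0) (y′u≡0 : y j′ u ≡ 0) → j < 2 ^ r → j′ < 2 ^ r
                  → pivot (agree j j′) ≡ just u → F (Raise.J j u u≤ yu≡0) (Raise.J j′ u u≤ y′u≡0) ⊕ F j j′ ≈ 0#) where

      agreement : ℕ → ℕ → Bool
      agreement t = agree (t + D₁) (t + D₂)

      term : ℕ → Carrier
      term t = F (t + D₁) (t + D₂)

      private
        t+D₁< : ∀ t → t < K → t + D₁ < 2 ^ r
        t+D₁< t t< = proj₁ (offsets-< t< K+D₁+D₂≡2^r)

        t+D₂< : ∀ t → t < K → t + D₂ < 2 ^ r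
        t+D₂< t t< = proj₂ (offsets-< t< K+D₁+D₂≡2^r)

        <K : ∀ t → t + D₁ + D₂ < 2 ^ r → t < K
        <K t lt = +-cancelʳ-< (D₁ + D₂) t K (subst₂ _<_ (+-assoc t D₁ D₂) (trans (sym K+D₁+D₂≡2^r) (+-assoc K D₁ D₂)) lt)

      raise-step : ∀ t u → t < K → pivot (agreement t) ≡ just u → y (t + D₁) u ≡ 0
                   → t + 2 ^ p u < K × pivot (agreement (t + 2 ^ p u)) ≡ just u × y (t + 2 ^ p u + D₁) u ≡ 1
                     × term (t + 2 ^ p u) ⊕ term t ≈ 0#
      raise-step t u t< pivot≡u yu≡0 = t′< , pivot′≡u , y′u≡1 , cancels
        where
        b = p u
        u≤ = proj₁ (pivot-true (agreement t) u pivot≡u)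
        y₂u≡0 : y (t + D₂) u ≡ 0
        y₂u≡0 = trans (sym (agree⇒ (t + D₁) (t + D₂) u (proj₂ (pivot-true (agreement t) u pivot≡u)))) yu≡0
        shift₁ : t + 2 ^ b + D₁ ≡ t + D₁ + 2 ^ b
        shift₁ = xy∙z≈xz∙y t (2 ^ b) D₁
        shift₂ : t + 2 ^ b + D₂ ≡ t + D₂ + 2 ^ b
        shift₂ = xy∙z≈xz∙y t (2 ^ b) D₂
        pivot′≡u : pivot (agreement (t + 2 ^ b)) ≡ just u
        pivot′≡u = trans (pivot-cong _ _ (λ a a≤ → trans (cong₂ (λ x x′ → agree x x′ a) shift₁ shift₂)
                                                          (agree-raise (t + D₁) (t + D₂) u u≤ yu≡0 y₂u≡0 a a≤)))
                         pivot≡u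
        y′u≡1 : y (t + 2 ^ b + D₁) u ≡ 1
        y′u≡1 = trans (cong (λ x → y x u) shift₁) (Raise.y-at (t + D₁) u u≤ yu≡0)
        t′< : t + 2 ^ b < K
        t′< = <K (t + 2 ^ b) (raised< D₁≡0⊎D₂≡0)
          where
          raised< : D₁ ≡ 0 ⊎ D₂ ≡ 0 → t + 2 ^ b + D₁ + D₂ < 2 ^ r
          raised< (inj₁ refl) = subst (_< 2 ^ r) (sym (trans (cong (_+ D₂) (+-identityʳ (t + 2 ^ b))) shift₂))
                                      (Raise.J-< (t + D₂) u u≤ y₂u≡0 (t+D₂< t t<))
          raised< (inj₂ refl) = subst (_< 2 ^ r) (sym (trans (+-identityʳ _) shift₁))
                                      (Raise.J-< (t + D₁) u u≤ yu≡0 (t+D₁< t t<))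
        cancels : term (t + 2 ^ b) ⊕ term t ≈ 0#
        cancels = ≈-trans (⊕-cong (≈-reflexive (cong₂ F shift₁ shift₂)) ≈-refl)
                          (paired (t + D₁) (t + D₂) u u≤ yu≡0 y₂u≡0 (t+D₁< t t<) (t+D₂< t t<) pivot≡u)

      lower-step : ∀ t u → t < K → pivot (agreement t) ≡ just u → y (t + D₁) u ≡ 1
                   → Σ[ t₀ ∈ ℕ ] t₀ + 2 ^ p u ≡ t × t₀ < K × pivot (agreement t₀) ≡ just u × y (t₀ + D₁) u ≡ 0
      lower-step t u t< pivot≡u yu≡1 = t ∸ 2 ^ b , m∸n+n≡m 2^b≤t , ≤-<-trans (m∸n≤m t (2 ^ b)) t< , pivot₀≡u ,
                                       trans (cong (λ x → y x u) (t₀+D≡ D₁ x₁ t+D₁≡)) x₁u≡0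
        where
        b = p u
        u≤ = proj₁ (pivot-true (agreement t) u pivot≡u)
        y₂u≡1 : y (t + D₂) u ≡ 1
        y₂u≡1 = trans (sym (agree⇒ (t + D₁) (t + D₂) u (proj₂ (pivot-true (agreement t) u pivot≡u)))) yu≡1
        lowered₁ = bit≡1⇒+2^ (t + D₁) b yu≡1
        lowered₂ = bit≡1⇒+2^ (t + D₂) b y₂u≡1
        x₁ = proj₁ lowered₁
        x₂ = proj₁ lowered₂
        t+D₁≡ = proj₁ (proj₂ lowered₁)
        t+D₂≡ = proj₁ (proj₂ lowered₂)
        x₁u≡0 = proj₂ (proj₂ lowered₁)
        x₂u≡0 = proj₂ (proj₂ lowered₂)
        2^b≤t : 2 ^ b ≤ t
        2^b≤t = from-zero D₁≡0⊎D₂≡0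
          where
          from-zero : D₁ ≡ 0 ⊎ D₂ ≡ 0 → 2 ^ b ≤ t
          from-zero (inj₁ refl) = subst (2 ^ b ≤_) (sym (trans (sym (+-identityʳ t)) t+D₁≡)) (m≤n+m (2 ^ b) x₁)
          from-zero (inj₂ refl) = subst (2 ^ b ≤_) (sym (trans (sym (+-identityʳ t)) t+D₂≡)) (m≤n+m (2 ^ b) x₂)
        t₀+D≡ : ∀ D x → t + D ≡ x + 2 ^ b → t ∸ 2 ^ b + D ≡ x
        t₀+D≡ D x eq = +-cancelʳ-≡ (2 ^ b) (t ∸ 2 ^ b + D) x
          (trans (xy∙z≈xz∙y (t ∸ 2 ^ b) D (2 ^ b)) (trans (cong (_+ D) (m∸n+n≡m 2^b≤t)) eq))
        pivot₀≡u : pivot (agreement (t ∸ 2 ^ b)) ≡ just u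
        pivot₀≡u = trans (pivot-cong _ _ same-pattern) pivot≡u
          where
          same-pattern : ∀ a → a ≤ suc n → agreement (t ∸ 2 ^ b) a ≡ agreement t a
          same-pattern a a≤ = begin
            agree (t ∸ 2 ^ b + D₁) (t ∸ 2 ^ b + D₂) a                       ≡⟨ cong₂ (λ x x′ → agree x x′ a) (t₀+D≡ D₁ x₁ t+D₁≡) (t₀+D≡ D₂ x₂ t+D₂≡) ⟩
            agree x₁ x₂ a                                                   ≡⟨ agree-raise x₁ x₂ u u≤ x₁u≡0 x₂u≡0 a a≤ ⟨
            agree (x₁ + 2 ^ b) (x₂ + 2 ^ b) a                               ≡⟨ cong₂ (λ x x′ → agree x x′ a) t+D₁≡ t+D₂≡ ⟨
            agree (t + D₁) (t + D₂) a                                       ∎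
            where open ≡-Reasoning

      toggleAt : ℕ → ℕ → ℕ → ℕ
      toggleAt zero    b t = t + 2 ^ b
      toggleAt (suc _) b t = t ∸ 2 ^ b

      toggle : ℕ → ℕ
      toggle t = maybe (λ u → toggleAt (y (t + D₁) u) (p u) t) t (pivot (agreement t))

      toggle-fixed : ∀ t → pivot (agreement t) ≡ nothing → toggle t ≡ t
      toggle-fixed t eq rewrite eq = refl

      toggle-raise : ∀ t u → pivot (agreement t) ≡ just u → y (t + D₁) u ≡ 0 → toggle t ≡ t + 2 ^ p u
      toggle-raise t u eq yu≡0 rewrite eq | yu≡0 = refl

      toggle-lower : ∀ t u → pivot (agreement t) ≡ just u → y (t + D₁) u ≡ 1 → toggle t ≡ t ∸ 2 ^ p u
      toggle-lower t u eq yu≡1 rewrite eq | yu≡1 = refl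

      private
        lowered≡ : ∀ t t₀ b → t₀ + 2 ^ b ≡ t → t ∸ 2 ^ b ≡ t₀
        lowered≡ t t₀ b refl = m+n∸n≡m t₀ (2 ^ b)

      toggle-< : ∀ t → t < K → toggle t < K
      toggle-< t t< with pivot (agreement t) in eq
      ... | nothing = t<
      ... | just u with bit-binary (t + D₁) (p u)
      ...   | inj₁ yu≡0 rewrite yu≡0 = proj₁ (raise-step t u t< eq yu≡0)
      ...   | inj₂ yu≡1 rewrite yu≡1 with lower-step t u t< eq yu≡1
      ...     | t₀ , t₀+ , t₀< , _ = subst (_< K) (sym (lowered≡ t t₀ (p u) t₀+)) t₀<

      toggle-involutive : ∀ t → t < K → toggle (toggle t) ≡ t
      toggle-involutive t t< with pivot (agreement t) in eq
      ... | nothing = toggle-fixed t eq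
      ... | just u with bit-binary (t + D₁) (p u)
      ...   | inj₁ yu≡0 rewrite yu≡0 with raise-step t u t< eq yu≡0
      ...     | _ , eq′ , y′u≡1 , _ = trans (toggle-lower _ u eq′ y′u≡1) (m+n∸n≡m t (2 ^ p u))
      toggle-involutive t t< | just u | inj₂ yu≡1 rewrite yu≡1 with lower-step t u t< eq yu≡1
      ...     | t₀ , t₀+ , _ , eq₀ , y₀u≡0 = trans (cong toggle (lowered≡ t t₀ (p u) t₀+)) (trans (toggle-raise t₀ u eq₀ y₀u≡0) t₀+)

      toggle-cancels : ∀ t → t < K → term (toggle t) ⊕ term t ≈ 0#
      toggle-cancels t t< with pivot (agreement t) in eq
      ... | nothing = ≈-trans (⊕-cong (unpaired t t< eq) (unpaired t t< eq)) (⊕-identityˡ 0#)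
      ... | just u with bit-binary (t + D₁) (p u)
      ...   | inj₁ yu≡0 rewrite yu≡0 = proj₂ (proj₂ (proj₂ (raise-step t u t< eq yu≡0)))
      ...   | inj₂ yu≡1 rewrite yu≡1 with lower-step t u t< eq yu≡1
      ...     | t₀ , t₀+ , t₀< , eq₀ , y₀u≡0 = begin
                term (t ∸ 2 ^ p u) ⊕ term t           ≡⟨ cong₂ (λ a b → term a ⊕ term b) (lowered≡ t t₀ (p u) t₀+) (sym t₀+) ⟩
                term t₀ ⊕ term (t₀ + 2 ^ p u)         ≈⟨ ⊕-comm _ _ ⟩
                term (t₀ + 2 ^ p u) ⊕ term t₀         ≈⟨ proj₂ (proj₂ (proj₂ (raise-step t₀ u t₀< eq₀ y₀u≡0))) ⟩
                0#                                    ∎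
        where open import Relation.Binary.Reasoning.Setoid (CommutativeRing.setoid R)

      segment-sum≈0 : sumR R K term ≈ 0#
      segment-sum≈0 = sumR-involution R dom char0 K term toggle toggle-< toggle-involutive toggle-cancels

module Correlations where

  open import Defs
  open Binary
  open NatSums
  open Paths
  open Pivots
  open RingLemmas
  open PivotPairing
  open import Level using (Level)
  open import Algebra.Bundles using (CommutativeRing)
  open import Data.Nat using (ℕ; suc; _+_; _*_; _∸_; _^_; _≤_; _<_; z≤n; s≤s)
  open import Data.Nat.Properties
  open import Data.Nat.DivMod using (_/_; m*n/n≡m)
  open import Data.Fin using (Fin; toℕ; fromℕ)
  open import Data.Fin.Properties using (toℕ-fromℕ)
  open import Data.Fin.Permutation using (Permutation′; _⟨$⟩ʳ_)
  open import Data.Maybe using (just; nothing)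
  open import Data.Bool using (true; false)
  open import Data.Sum using (_⊎_; inj₁; inj₂)
  open import Data.Product using (_×_; _,_; proj₁; proj₂)
  open import Data.Empty using (⊥-elim)
  open import Relation.Nullary using (¬_; yes; no)
  open import Relation.Binary.PropositionalEquality hiding (J)
  import Data.Nat.Tactic.RingSolver as ℕ-Solver
  open import Algebra.Properties.CommutativeSemigroup +-commutativeSemigroup using (xy∙z≈xz∙y; interchange)

  module Correlation {ℓ₁ ℓ₂ : Level} (R : CommutativeRing ℓ₁ ℓ₂) (dom : IsIntegralDomain R) (char0 : CharZero R)
      (k : ℕ) (ω : CommutativeRing.Carrier R)
      (ω^q≈1 : CommutativeRing._≈_ R (pow R ω (suc k * 2)) (CommutativeRing.1# R))
      (ω^h≉1 : ¬ CommutativeRing._≈_ R (pow R ω (suc k)) (CommutativeRing.1# R))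
      (n : ℕ) (π : Permutation′ (suc (suc n))) (e f : Fin (suc (suc n)) → Fin (suc k * 2)) where

    open Signs R dom k ω ω^q≈1 ω^h≉1
    open Path n π
    open CommutativeRing R using (Carrier; _≈_; 0#)
      renaming (_+_ to _⊕_; _*_ to _⊛_; +-cong to ⊕-cong; +-congˡ to ⊕-congˡ; +-congʳ to ⊕-congʳ; +-comm to ⊕-comm; +-identityˡ to ⊕-identityˡ;
                distribʳ to ⊛-distribʳ; sym to ≈-sym; trans to ≈-trans; refl to ≈-refl; reflexive to ≈-reflexive)

    M : ℕ
    M = 2 ^ r

    G : ℕ → ℕ → ℕ
    G d i = g q n π e f d i

    eₙ fₙ : ℕ → ℕ
    eₙ = extend (λ j → toℕ (e j))
    fₙ = extend (λ j → toℕ (f j))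

    linear₁ linear₂ linear : ℕ → ℕ
    linear₁ i = sumN r (λ c → eₙ c * bit i c)
    linear₂ i = sumN r (λ c → fₙ c * bar (bit i c))
    linear i = linear₁ i + linear₂ i

    bracket : ℕ → ℕ → ℕ
    bracket d i = bit i (n + 2) * bar (bit i (n + 3)) * (Q i + d * yLast i)
                + bar (bit i (n + 2)) * bit i (n + 3) * (Q̄ i + bar d * yLast i)
                + d * bar (bit i (n + 2)) * bar (bit i (n + 3))
                + bit i (n + 2) * bit i (n + 3)

    G≡ : ∀ d i → G d i ≡ h * bracket d i + linear i
    G≡ d i = begin
      (q / 2) * inner + lin₁ + lin₂     ≡⟨ cong₂ (λ a b → a * b + lin₁ + lin₂) (m*n/n≡m h 2) inner≡ ⟩
      h * bracket d i + lin₁ + lin₂     ≡⟨ +-assoc (h * bracket d i) lin₁ lin₂ ⟩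
      h * bracket d i + (lin₁ + lin₂)   ≡⟨ cong (λ z → h * bracket d i + z) (cong₂ _+_ lin₁≡ lin₂≡) ⟩
      h * bracket d i + linear i        ∎
      where
      open ≡-Reasoning
      xa = bit i (n + 2)
      xb = bit i (n + 3)
      inner = xa * bar xb * ζ n π d i + bar xa * xb * η n π d i + d * bar xa * bar xb + xa * xb
      lin₁ = sumF r (λ j → toℕ (e j) * bit i (toℕ j))
      lin₂ = sumF r (λ j → toℕ (f j) * bar (bit i (toℕ j)))
      inner≡ : inner ≡ bracket d i
      inner≡ = cong₂ (λ a b → xa * bar xb * a + bar xa * xb * b + d * bar xa * bar xb + xa * xb) (ζ≡Q d i) (η≡Q̄ d i)
      lin₁≡ : lin₁ ≡ linear₁ i
      lin₁≡ = sumF≡sumN r _ (λ c → eₙ c * bit i c) (λ j → cong (_* bit i (toℕ j)) (sym (extend-toℕ (λ j → toℕ (e j)) j)))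
      lin₂≡ : lin₂ ≡ linear₂ i
      lin₂≡ = sumF≡sumN r _ (λ c → fₙ c * bar (bit i c)) (λ j → cong (_* bar (bit i (toℕ j))) (sym (extend-toℕ (λ j → toℕ (f j)) j)))

    -- The contribution of positions i and i′ of Ψ(g^0) and Ψ(g^1) to ρ_a(τ) + ρ_b(τ).
    Φ : ℕ → ℕ → Carrier
    Φ i i′ = Ωdiff (G 0 i) (G 0 i′) ⊕ Ωdiff (G 1 i) (G 1 i′)

    signs : ℕ → ℕ → ℕ → Carrier
    signs d i i′ = ν^ (bracket d i) ⊛ ν^ (bracket d i′)

    Φ≈ : ∀ i i′ → Φ i i′ ≈ (signs 0 i i′ ⊕ signs 1 i i′) ⊛ Ωdiff (linear i) (linear i′)
    Φ≈ i i′ = ≈-trans (⊕-cong (split 0) (split 1)) (≈-sym (⊛-distribʳ _ _ _))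
      where
      split : ∀ d → Ωdiff (G d i) (G d i′) ≈ signs d i i′ ⊛ Ωdiff (linear i) (linear i′)
      split d = ≈-trans (≈-reflexive (cong₂ Ωdiff (G≡ d i) (G≡ d i′))) (Ωdiff-split (bracket d i) (linear i) (bracket d i′) (linear i′))

    -- Indices j + M w, j < M, w < 4: the quadrant w is (x_{m-2}, x_{m-1}) read as a binary number.
    private
      bit-low : ∀ j w c → j < M → c < r → bit (j + M * w) c ≡ bit j c
      bit-low j w c j< c< = bit-+2^*-low r j w j< c c<

      x-m-2 : ∀ j w → j < M → bit (j + M * w) (n + 2) ≡ bit w 0
      x-m-2 j w j< = trans (cong (bit (j + M * w)) (trans (+-comm n 2) (sym (+-identityʳ r)))) (bit-+2^*-high r j w j< 0)

      x-m-1 : ∀ j w → j < M → bit (j + M * w) (n + 3) ≡ bit w 1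
      x-m-1 j w j< = trans (cong (bit (j + M * w)) (trans (+-comm n 3) (+-comm 1 r))) (bit-+2^*-high r j w j< 1)

      y-quadrant : ∀ j w a → j < M → a ≤ suc n → y (j + M * w) a ≡ y j a
      y-quadrant j w a j< a≤ = bit-low j w (p a) j< (p-< a (s≤s a≤))

      Q-quadrant : ∀ j w → j < M → Q (j + M * w) ≡ Q j
      Q-quadrant j w j< = sumN-cong (suc n) _ _ (λ i i< → cong₂ _*_ (y-quadrant j w i j< (<⇒≤ i<)) (y-quadrant j w (suc i) j< i<))

      Q̄-quadrant : ∀ j w → j < M → Q̄ (j + M * w) ≡ Q̄ j
      Q̄-quadrant j w j< = sumN-cong (suc n) _ _ (λ i i< → cong₂ (λ a b → bar a * bar b) (y-quadrant j w i j< (<⇒≤ i<)) (y-quadrant j w (suc i) j< i<))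

      linear-quadrant : ∀ j w → j < M → linear (j + M * w) ≡ linear j
      linear-quadrant j w j< = cong₂ _+_ (sumN-cong r _ _ (λ c c< → cong (eₙ c *_) (bit-low j w c j< c<)))
                                         (sumN-cong r _ _ (λ c c< → cong (λ z → fₙ c * bar z) (bit-low j w c j< c<)))

    quadrantBracket : ℕ → ℕ → ℕ → ℕ
    quadrantBracket 0 d j = d
    quadrantBracket 1 d j = Q j + d * yLast j
    quadrantBracket 2 d j = Q̄ j + bar d * yLast j
    quadrantBracket _ d j = 1

    bracket-quadrant : ∀ d j w → j < M → w < 4 → bracket d (j + M * w) ≡ quadrantBracket w d j
    bracket-quadrant d j w j< w<
      rewrite x-m-2 j w j< | x-m-1 j w j< | Q-quadrant j w j< | Q̄-quadrant j w j< | y-quadrant j w (suc n) j< ≤-refl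
      = by-quadrant w w<
      where
      by-quadrant : ∀ w → w < 4 → bit w 0 * bar (bit w 1) * (Q j + d * yLast j) + bar (bit w 0) * bit w 1 * (Q̄ j + bar d * yLast j)
                                  + d * bar (bit w 0) * bar (bit w 1) + bit w 0 * bit w 1 ≡ quadrantBracket w d j
      by-quadrant 0 _ = trans (+-identityʳ _) (trans (*-identityʳ _) (*-identityʳ d))
      by-quadrant 1 _ rewrite *-zeroʳ d = trans (+-identityʳ _) (trans (+-identityʳ _) (trans (+-identityʳ _) (*-identityˡ _)))
      by-quadrant 2 _ rewrite *-zeroʳ (d * 1) = trans (+-identityʳ _) (trans (+-identityʳ _) (*-identityˡ _))
      by-quadrant 3 _ rewrite *-zeroʳ d = refl
      by-quadrant (suc (suc (suc (suc w)))) (s≤s (s≤s (s≤s (s≤s ()))))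

    Φq : ℕ → ℕ → ℕ → ℕ → Carrier
    Φq w₁ w₂ j j′ = Φ (j + M * w₁) (j′ + M * w₂)

    qsigns : ℕ → ℕ → ℕ → ℕ → ℕ → Carrier
    qsigns w₁ w₂ d j j′ = ν^ (quadrantBracket w₁ d j) ⊛ ν^ (quadrantBracket w₂ d j′)

    Φq≈ : ∀ w₁ w₂ j j′ → j < M → j′ < M → w₁ < 4 → w₂ < 4
          → Φq w₁ w₂ j j′ ≈ (qsigns w₁ w₂ 0 j j′ ⊕ qsigns w₁ w₂ 1 j j′) ⊛ Ωdiff (linear j) (linear j′)
    Φq≈ w₁ w₂ j j′ j< j′< w₁< w₂< = ≈-trans (Φ≈ _ _) (≈-reflexive (cong₂ _⊛_
      (cong₂ _⊕_ (cong₂ (λ a b → ν^ a ⊛ ν^ b) (bracket-quadrant 0 j w₁ j< w₁<) (bracket-quadrant 0 j′ w₂ j′< w₂<))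
                 (cong₂ (λ a b → ν^ a ⊛ ν^ b) (bracket-quadrant 1 j w₁ j< w₁<) (bracket-quadrant 1 j′ w₂ j′< w₂<)))
      (cong₂ Ωdiff (linear-quadrant j w₁ j<) (linear-quadrant j′ w₂ j′<))))

    module _ (j u : ℕ) (u≤ : u ≤ suc n) (yu≡0 : y j u ≡ 0) where
      open Raise j u u≤ yu≡0

      linear-raise : linear J + fₙ (p u) ≡ linear j + eₙ (p u)
      linear-raise = begin
        linear₁ J + linear₂ J + fₙ c      ≡⟨ +-assoc (linear₁ J) (linear₂ J) (fₙ c) ⟩
        linear₁ J + (linear₂ J + fₙ c)    ≡⟨ cong₂ _+_ raise₁ raise₂ ⟩
        (linear₁ j + eₙ c) + linear₂ j    ≡⟨ xy∙z≈xz∙y (linear₁ j) (eₙ c) (linear₂ j) ⟩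
        linear₁ j + linear₂ j + eₙ c      ∎
        where
        open ≡-Reasoning
        c = p u
        c< = p-< u (s≤s u≤)
        bitJ : ∀ c′ → c′ ≢ c → bit J c′ ≡ bit j c′
        bitJ = bit-+2^-elsewhere j c yu≡0
        raise₁ : linear₁ J ≡ linear₁ j + eₙ c
        raise₁ = begin
          linear₁ J                 ≡⟨ +-identityʳ _ ⟨
          linear₁ J + 0             ≡⟨ cong (linear₁ J +_) (*-zeroʳ (eₙ c)) ⟨
          linear₁ J + eₙ c * 0      ≡⟨ subst₂ (λ x x′ → linear₁ J + eₙ c * x ≡ linear₁ j + eₙ c * x′) yu≡0 y-at
                                         (sumN-differ-at r c (λ c′ → eₙ c′ * bit j c′) (λ c′ → eₙ c′ * bit J c′) c<
                                                         (λ i i≢ → cong (eₙ i *_) (bitJ i i≢))) ⟩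
          linear₁ j + eₙ c * 1      ≡⟨ cong (linear₁ j +_) (*-identityʳ (eₙ c)) ⟩
          linear₁ j + eₙ c          ∎
        raise₂ : linear₂ J + fₙ c ≡ linear₂ j
        raise₂ = begin
          linear₂ J + fₙ c          ≡⟨ cong (linear₂ J +_) (*-identityʳ (fₙ c)) ⟨
          linear₂ J + fₙ c * 1      ≡⟨ subst₂ (λ x x′ → linear₂ J + fₙ c * bar x ≡ linear₂ j + fₙ c * bar x′) yu≡0 y-at
                                         (sumN-differ-at r c (λ c′ → fₙ c′ * bar (bit j c′)) (λ c′ → fₙ c′ * bar (bit J c′)) c<
                                                         (λ i i≢ → cong (λ z → fₙ i * bar z) (bitJ i i≢))) ⟩
          linear₂ j + fₙ c * 0      ≡⟨ cong (linear₂ j +_) (*-zeroʳ (fₙ c)) ⟩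
          linear₂ j + 0             ≡⟨ +-identityʳ _ ⟩
          linear₂ j                 ∎

    module _ (j j′ u : ℕ) (u≤ : u ≤ suc n) (yu≡0 : y j u ≡ 0) (y′u≡0 : y j′ u ≡ 0) where
      private
        J  = Raise.J j u u≤ yu≡0
        J′ = Raise.J j′ u u≤ y′u≡0

      Ωdiff-linear-raise : Ωdiff (linear J) (linear J′) ≈ Ωdiff (linear j) (linear j′)
      Ωdiff-linear-raise = Ωdiff-cong (linear J) (linear J′) (linear j) (linear j′) (+-cancelʳ-≡ (f′ + e′) _ _ (begin
        (linear J + linear j′) + (f′ + e′)   ≡⟨ interchange (linear J) (linear j′) f′ e′ ⟩
        (linear J + f′) + (linear j′ + e′)   ≡⟨ cong₂ _+_ (linear-raise j u u≤ yu≡0) (sym (linear-raise j′ u u≤ y′u≡0)) ⟩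
        (linear j + e′) + (linear J′ + f′)   ≡⟨ interchange (linear j) e′ (linear J′) f′ ⟩
        (linear j + linear J′) + (e′ + f′)   ≡⟨ cong (linear j + linear J′ +_) (+-comm e′ f′) ⟩
        (linear j + linear J′) + (f′ + e′)   ∎))
        where
        open ≡-Reasoning
        e′ = eₙ (p u)
        f′ = fₙ (p u)

      paired-cancel : ∀ w₁ w₂ → j < M → j′ < M → w₁ < 4 → w₂ < 4 → (∀ d → d ≤ 1 → qsigns w₁ w₂ d J J′ ≈ ν ⊛ qsigns w₁ w₂ d j j′)
                      → Φq w₁ w₂ J J′ ⊕ Φq w₁ w₂ j j′ ≈ 0#
      paired-cancel w₁ w₂ j< j′< w₁< w₂< flips =
        ≈-trans (⊕-cong (Φq≈ w₁ w₂ J J′ (Raise.J-< j u u≤ yu≡0 j<) (Raise.J-< j′ u u≤ y′u≡0 j′<) w₁< w₂<) (Φq≈ w₁ w₂ j j′ j< j′< w₁< w₂<))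
                (cancel-pair _ _ _ _ _ _ (flips 0 z≤n) (flips 1 ≤-refl) Ωdiff-linear-raise)

    unpaired-cancel : ∀ w₁ w₂ j j′ → j < M → j′ < M → w₁ < 4 → w₂ < 4
                      → qsigns w₁ w₂ 1 j j′ ≈ ν ⊛ qsigns w₁ w₂ 0 j j′ → Φq w₁ w₂ j j′ ≈ 0#
    unpaired-cancel w₁ w₂ j j′ j< j′< w₁< w₂< flip = ≈-trans (Φq≈ w₁ w₂ j j′ j< j′< w₁< w₂<) (cancel-self _ _ _ flip)

    private
      0<4 : 0 < 4
      0<4 = s≤s z≤n
      1<4 : 1 < 4
      1<4 = s≤s (s≤s z≤n)
      2<4 : 2 < 4
      2<4 = s≤s (s≤s (s≤s z≤n))
      3<4 : 3 < 4
      3<4 = s≤s (s≤s (s≤s (s≤s z≤n)))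

      parity-last : ∀ Q Q′ A A′ → A + A′ ≡ 1 → (Q + 1 * A) + (Q′ + 1 * A′) + 2 * 0 ≡ suc ((Q + 0 * A) + (Q′ + 0 * A′)) + 2 * 0
      parity-last Q Q′ A A′ A+A′≡1 = trans (regroup Q Q′ A A′) (trans (cong (_+ (Q + Q′)) A+A′≡1) (regroup′ Q Q′ A A′))
        where
        regroup : ∀ Q Q′ A A′ → (Q + 1 * A) + (Q′ + 1 * A′) + 2 * 0 ≡ (A + A′) + (Q + Q′)
        regroup = ℕ-Solver.solve-∀
        regroup′ : ∀ Q Q′ A A′ → 1 + (Q + Q′) ≡ suc ((Q + 0 * A) + (Q′ + 0 * A′)) + 2 * 0
        regroup′ = ℕ-Solver.solve-∀

      parity-last-cross : ∀ Q X A A′ → A + A′ ≡ 1 → (Q + 1 * A) + (X + 0 * A′) + 2 * A′ ≡ suc ((Q + 0 * A) + (X + 1 * A′)) + 2 * 0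
      parity-last-cross Q X A A′ A+A′≡1 = trans (regroup Q X A A′) (trans (cong (_+ (Q + X + A′)) A+A′≡1) (regroup′ Q X A A′))
        where
        regroup : ∀ Q X A A′ → (Q + 1 * A) + (X + 0 * A′) + 2 * A′ ≡ (A + A′) + (Q + X + A′)
        regroup = ℕ-Solver.solve-∀
        regroup′ : ∀ Q X A A′ → 1 + (Q + X + A′) ≡ suc ((Q + 0 * A) + (X + 1 * A′)) + 2 * 0
        regroup′ = ℕ-Solver.solve-∀

    yLast-differ : ∀ j j′ → agree j j′ (suc n) ≡ false → yLast j + yLast j′ ≡ 1
    yLast-differ j j′ zf = ≢⇒+≡1 (yLast j) (yLast j′) (bit≤1 j (p (suc n))) (bit≤1 j′ (p (suc n))) (disagree⇒ j j′ (suc n) zf)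

    unpaired₁₁ : ∀ j j′ → j < M → j′ < M → j ≢ j′ → pivotSame n (agree j j′) ≡ nothing → Φq 1 1 j j′ ≈ 0#
    unpaired₁₁ j j′ j< j′< j≢j′ eq with pivotSame-nothing n (agree j j′) eq
    ... | inj₂ all = ⊥-elim (j≢j′ (agree-everywhere j j′ j< j′< all))
    ... | inj₁ zf  = unpaired-cancel 1 1 j j′ j< j′< 1<4 1<4
                       (ν^-flip (Q j + 1 * yLast j) (Q j′ + 1 * yLast j′) (Q j + 0 * yLast j) (Q j′ + 0 * yLast j′) 0 0 (parity-last (Q j) (Q j′) (yLast j) (yLast j′) (yLast-differ j j′ zf)))

    unpaired₂₂ : ∀ j j′ → j < M → j′ < M → j ≢ j′ → pivotSame n (agree j j′) ≡ nothing → Φq 2 2 j j′ ≈ 0#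
    unpaired₂₂ j j′ j< j′< j≢j′ eq with pivotSame-nothing n (agree j j′) eq
    ... | inj₂ all = ⊥-elim (j≢j′ (agree-everywhere j j′ j< j′< all))
    ... | inj₁ zf  = unpaired-cancel 2 2 j j′ j< j′< 2<4 2<4 (ν*-swap _ _
                       (ν^-flip (Q̄ j + 1 * yLast j) (Q̄ j′ + 1 * yLast j′) (Q̄ j + 0 * yLast j) (Q̄ j′ + 0 * yLast j′) 0 0 (parity-last (Q̄ j) (Q̄ j′) (yLast j) (yLast j′) (yLast-differ j j′ zf))))

    unpaired₁₂ : ∀ j j′ → j < M → j′ < M → pivotCross n (agree j j′) ≡ nothing → Φq 1 2 j j′ ≈ 0#
    unpaired₁₂ j j′ j< j′< eq = unpaired-cancel 1 2 j j′ j< j′< 1<4 2<4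
      (ν^-flip (Q j + 1 * yLast j) (Q̄ j′ + 0 * yLast j′) (Q j + 0 * yLast j) (Q̄ j′ + 1 * yLast j′) (yLast j′) 0
        (parity-last-cross (Q j) (Q̄ j′) (yLast j) (yLast j′) (yLast-differ j j′ (pivotCross-nothing n (agree j j′) eq))))

    private
      flip-same : ∀ P P′ P₀ P₀′ Q Q′ a a′ R d A B → P ≡ Q + (a + R) + d * B → P′ ≡ Q′ + (a′ + R) + d * B
                  → P₀ ≡ Q + d * A → P₀′ ≡ Q′ + d * A → a + a′ ≡ 1 → ν^ P ⊛ ν^ P′ ≈ ν ⊛ (ν^ P₀ ⊛ ν^ P₀′)
      flip-same _ _ _ _ Q Q′ a a′ R d A B refl refl refl refl a+a′≡1 =
        ν^-flip (Q + (a + R) + d * B) (Q′ + (a′ + R) + d * B) (Q + d * A) (Q′ + d * A) (d * A) (R + d * B) (begin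
        (Q + (a + R) + d * B) + (Q′ + (a′ + R) + d * B) + 2 * (d * A)   ≡⟨ regroup Q Q′ a a′ R d A B ⟩
        (a + a′) + S                                                     ≡⟨ cong (_+ S) a+a′≡1 ⟩
        1 + S                                                            ≡⟨ regroup′ Q Q′ R d A B ⟩
        suc ((Q + d * A) + (Q′ + d * A)) + 2 * (R + d * B)               ∎)
        where
        open ≡-Reasoning
        S = Q + Q′ + 2 * R + 2 * (d * B) + 2 * (d * A)
        regroup : ∀ Q Q′ a a′ R d A B → (Q + (a + R) + d * B) + (Q′ + (a′ + R) + d * B) + 2 * (d * A)
                                       ≡ (a + a′) + (Q + Q′ + 2 * R + 2 * (d * B) + 2 * (d * A))
        regroup = ℕ-Solver.solve-∀
        regroup′ : ∀ Q Q′ R d A B → 1 + (Q + Q′ + 2 * R + 2 * (d * B) + 2 * (d * A)) ≡ suc ((Q + d * A) + (Q′ + d * A)) + 2 * (R + d * B)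
        regroup′ = ℕ-Solver.solve-∀

      flip-cross : ∀ P P′ P₀ P₀′ Q X ℓ R R̄ d d̄ A B → P ≡ Q + (ℓ + R) + d * B → P′ ≡ X + d̄ * B
                   → P₀ ≡ Q + d * A → P₀′ ≡ X + (ℓ + R̄) + d̄ * A → d + d̄ ≡ 1 → B + (R + R̄) ≡ suc A
                   → ν^ P ⊛ ν^ P′ ≈ ν ⊛ (ν^ P₀ ⊛ ν^ P₀′)
      flip-cross _ _ _ _ Q X ℓ R R̄ d d̄ A B refl refl refl refl d+d̄≡1 right≡ =
        ν^-flip (Q + (ℓ + R) + d * B) (X + d̄ * B) (Q + d * A) (X + (ℓ + R̄) + d̄ * A) R̄ 0 (begin
        (Q + (ℓ + R) + d * B) + (X + d̄ * B) + 2 * R̄                   ≡⟨ regroup Q X ℓ R R̄ d d̄ B ⟩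
        S + ((d + d̄) * B + (R + R̄))                                    ≡⟨ cong (λ s → S + (s * B + (R + R̄))) d+d̄≡1 ⟩
        S + (1 * B + (R + R̄))                                          ≡⟨ cong (λ b → S + (b + (R + R̄))) (*-identityˡ B) ⟩
        S + (B + (R + R̄))                                              ≡⟨ cong (S +_) right≡ ⟩
        S + suc A                                                      ≡⟨ cong (λ a → S + suc a) (*-identityˡ A) ⟨
        S + suc (1 * A)                                                ≡⟨ cong (λ s → S + suc (s * A)) d+d̄≡1 ⟨
        S + suc ((d + d̄) * A)                                          ≡⟨ regroup′ Q X ℓ R̄ d d̄ A ⟩
        suc ((Q + d * A) + (X + (ℓ + R̄) + d̄ * A)) + 2 * 0              ∎)
        where
        open ≡-Reasoning
        S = Q + X + ℓ + R̄
        regroup : ∀ Q X ℓ R R̄ d d̄ B → (Q + (ℓ + R) + d * B) + (X + d̄ * B) + 2 * R̄ ≡ (Q + X + ℓ + R̄) + ((d + d̄) * B + (R + R̄))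
        regroup = ℕ-Solver.solve-∀
        regroup′ : ∀ Q X ℓ R̄ d d̄ A → (Q + X + ℓ + R̄) + suc ((d + d̄) * A) ≡ suc ((Q + d * A) + (X + (ℓ + R̄) + d̄ * A)) + 2 * 0
        regroup′ = ℕ-Solver.solve-∀

    module RaisedPair (j j′ u : ℕ) (u≤ : u ≤ suc n) (yu≡0 : y j u ≡ 0) (y′u≡0 : y j′ u ≡ 0)
                      (above : ∀ a → u < a → a ≤ suc n → agree j j′ a ≡ true) (last : agree j j′ (suc n) ≡ true) where
      open Raise j u u≤ yu≡0 public using (J)
      open Raise j′ u u≤ y′u≡0 using () renaming (J to J′)

      yLast≡ : yLast j′ ≡ yLast j
      yLast≡ = sym (agree⇒ j j′ (suc n) last)

      yLast-raised≡ : yLast J′ ≡ yLast J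
      yLast-raised≡ = sym (agree⇒ J J′ (suc n) (trans (agree-raise j j′ u u≤ yu≡0 y′u≡0 (suc n) ≤-refl) last))

      right≡ : rightNeighbour (suc n) (y j′) u ≡ rightNeighbour (suc n) (y j) u
      right≡ = rightNeighbour-cong (suc n) (y j′) (y j) u (λ a u<a a≤ → sym (agree⇒ j j′ a (above a u<a a≤)))

      right-raised≡ : rightNeighbour (suc n) (λ a → bar (y J′ a)) u ≡ rightNeighbour (suc n) (λ a → bar (y J a)) u
      right-raised≡ = rightNeighbour-cong (suc n) (λ a → bar (y J′ a)) (λ a → bar (y J a)) u
        (λ a u<a a≤ → cong bar (sym (agree⇒ J J′ a (trans (agree-raise j j′ u u≤ yu≡0 y′u≡0 a a≤) (above a u<a a≤)))))

      right-and-last : yLast J + (rightNeighbour (suc n) (y j) u + rightNeighbour (suc n) (λ a → bar (y J′ a)) u) ≡ suc (yLast j)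
      right-and-last with m≤n⇒m<n∨m≡n u≤
      ... | inj₁ u<1+n = begin
        yLast J + (rightNeighbour (suc n) (y j) u + rightNeighbour (suc n) (λ a → bar (y J′ a)) u)
          ≡⟨ cong₂ _+_ (Raise.y-elsewhere j u u≤ yu≡0 (suc n) ≤-refl (>⇒≢ u<1+n))
                       (cong₂ _+_ (rightNeighbour-inner (suc n) (y j) u u<1+n) (rightNeighbour-inner (suc n) (λ a → bar (y J′ a)) u u<1+n)) ⟩
        yLast j + (y j (suc u) + bar (y J′ (suc u)))
          ≡⟨ cong (λ b → yLast j + (y j (suc u) + bar b)) (trans (Raise.y-elsewhere j′ u u≤ y′u≡0 (suc u) u<1+n 1+n≢n) (sym y-next≡)) ⟩
        yLast j + (y j (suc u) + bar (y j (suc u)))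
          ≡⟨ cong (yLast j +_) (b+bar≡1 (y j (suc u)) (bit≤1 j (p (suc u)))) ⟩
        yLast j + 1
          ≡⟨ +-comm (yLast j) 1 ⟩
        suc (yLast j)  ∎
        where
        open ≡-Reasoning
        y-next≡ : y j (suc u) ≡ y j′ (suc u)
        y-next≡ = agree⇒ j j′ (suc u) (above (suc u) ≤-refl u<1+n)
      ... | inj₂ refl = begin
        yLast J + (rightNeighbour (suc n) (y j) (suc n) + rightNeighbour (suc n) (λ a → bar (y J′ a)) (suc n))
          ≡⟨ cong₂ (λ b r → b + (r + rightNeighbour (suc n) (λ a → bar (y J′ a)) (suc n))) (Raise.y-at j u u≤ yu≡0) (rightNeighbour-end (suc n) (y j)) ⟩
        1 + rightNeighbour (suc n) (λ a → bar (y J′ a)) (suc n)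
          ≡⟨ cong suc (rightNeighbour-end (suc n) (λ a → bar (y J′ a))) ⟩
        1
          ≡⟨ cong suc yu≡0 ⟨
        suc (yLast j)  ∎
        where open ≡-Reasoning

    private
      same-pivot-above : ∀ {j j′ v} → (∀ a → v < a → a ≤ suc n → agree j j′ a ≡ true) → ∀ a → suc v < a → a ≤ suc n → agree j j′ a ≡ true
      same-pivot-above {v = v} rest a 1+v<a = rest a (<-trans (n<1+n v) 1+v<a)

      y-differ : ∀ j j′ v → agree j j′ v ≡ false → y j v + y j′ v ≡ 1
      y-differ j j′ v zv = ≢⇒+≡1 (y j v) (y j′ v) (bit≤1 j (p v)) (bit≤1 j′ (p v)) (disagree⇒ j j′ v zv)

    paired₁₁ : ∀ j j′ u (u≤ : u ≤ suc n) (yu≡0 : y j u ≡ 0) (y′u≡0 : y j′ u ≡ 0) → j < M → j′ < M → pivotSame n (agree j j′) ≡ just u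
               → Φq 1 1 (Raise.J j u u≤ yu≡0) (Raise.J j′ u u≤ y′u≡0) ⊕ Φq 1 1 j j′ ≈ 0#
    paired₁₁ j j′ u u≤ yu≡0 y′u≡0 j< j′< eq with pivotSame-just n (agree j j′) u eq
    ... | v , refl , v< , zv , rest = paired-cancel j j′ (suc v) u≤ yu≡0 y′u≡0 1 1 j< j′< 1<4 1<4 flips
      where
      open RaisedPair j j′ (suc v) u≤ yu≡0 y′u≡0 (same-pivot-above rest) (rest (suc n) v< ≤-refl)
      J′ = Raise.J j′ (suc v) u≤ y′u≡0
      right = rightNeighbour (suc n) (y j) (suc v)
      flips : ∀ d → d ≤ 1 → qsigns 1 1 d J J′ ≈ ν ⊛ qsigns 1 1 d j j′
      flips d _ = flip-same _ _ _ _ (Q j) (Q j′) (y j v) (y j′ v) right d (yLast j) (yLast J)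
        (cong (_+ d * yLast J) (Raise.Q-raise j (suc v) u≤ yu≡0))
        (cong₂ (λ x b → x + d * b) (trans (Raise.Q-raise j′ (suc v) u≤ y′u≡0) (cong (λ r → Q j′ + (y j′ v + r)) right≡)) yLast-raised≡)
        refl
        (cong (λ b → Q j′ + d * b) yLast≡)
        (y-differ j j′ v zv)

    paired₂₂ : ∀ j j′ u (u≤ : u ≤ suc n) (yu≡0 : y j u ≡ 0) (y′u≡0 : y j′ u ≡ 0) → j < M → j′ < M → pivotSame n (agree j j′) ≡ just u
               → Φq 2 2 (Raise.J j u u≤ yu≡0) (Raise.J j′ u u≤ y′u≡0) ⊕ Φq 2 2 j j′ ≈ 0#
    paired₂₂ j j′ u u≤ yu≡0 y′u≡0 j< j′< eq with pivotSame-just n (agree j j′) u eq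
    ... | v , refl , v< , zv , rest = paired-cancel j j′ (suc v) u≤ yu≡0 y′u≡0 2 2 j< j′< 2<4 2<4 flips
      where
      open RaisedPair j j′ (suc v) u≤ yu≡0 y′u≡0 (same-pivot-above rest) (rest (suc n) v< ≤-refl)
      J′ = Raise.J j′ (suc v) u≤ y′u≡0
      R̄ = rightNeighbour (suc n) (λ a → bar (y J a)) (suc v)
      y-below : ∀ x (yu≡0 : y x (suc v) ≡ 0) → y (Raise.J x (suc v) u≤ yu≡0) v ≡ y x v
      y-below x yu≡0 = Raise.y-elsewhere x (suc v) u≤ yu≡0 v (<⇒≤ v<) (<⇒≢ (n<1+n v))
      bars-differ : bar (y J v) + bar (y J′ v) ≡ 1
      bars-differ = begin
        bar (y J v) + bar (y J′ v)   ≡⟨ cong₂ (λ b b′ → bar b + bar b′) (y-below j yu≡0) (y-below j′ y′u≡0) ⟩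
        bar (y j v) + bar (y j′ v)   ≡⟨ cong₂ _+_ (≢⇒bar≡ _ _ (bit≤1 j′ (p v)) (bit≤1 j (p v)) (≢-sym j≢j′)) (≢⇒bar≡ _ _ (bit≤1 j (p v)) (bit≤1 j′ (p v)) j≢j′) ⟩
        y j′ v + y j v               ≡⟨ +-comm (y j′ v) (y j v) ⟩
        y j v + y j′ v               ≡⟨ y-differ j j′ v zv ⟩
        1                            ∎
        where
        open ≡-Reasoning
        j≢j′ = disagree⇒ j j′ v zv
      flips : ∀ d → d ≤ 1 → qsigns 2 2 d J J′ ≈ ν ⊛ qsigns 2 2 d j j′
      flips d _ = ν*-swap _ _ (flip-same _ _ _ _ (Q̄ J) (Q̄ J′) (bar (y J v)) (bar (y J′ v)) R̄ (bar d) (yLast J) (yLast j)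
        (cong (_+ bar d * yLast j) (Raise.Q̄-raise j (suc v) u≤ yu≡0))
        (cong₂ (λ x b → x + bar d * b) (trans (Raise.Q̄-raise j′ (suc v) u≤ y′u≡0) (cong (λ r → Q̄ J′ + (bar (y J′ v) + r)) right-raised≡)) yLast≡)
        refl
        (cong (λ b → Q̄ J′ + bar d * b) yLast-raised≡)
        bars-differ)

    paired₁₂ : ∀ j j′ u (u≤ : u ≤ suc n) (yu≡0 : y j u ≡ 0) (y′u≡0 : y j′ u ≡ 0) → j < M → j′ < M → pivotCross n (agree j j′) ≡ just u
               → Φq 1 2 (Raise.J j u u≤ yu≡0) (Raise.J j′ u u≤ y′u≡0) ⊕ Φq 1 2 j j′ ≈ 0#
    paired₁₂ j j′ u u≤ yu≡0 y′u≡0 j< j′< eq = paired-cancel j j′ u u≤ yu≡0 y′u≡0 1 2 j< j′< 1<4 2<4 flips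
      where
      J′ = Raise.J j′ u u≤ y′u≡0
      last = proj₁ (pivotCross-just n (agree j j′) u eq)
      above-and-left : (∀ a → u < a → a ≤ suc n → agree j j′ a ≡ true)
                       × leftNeighbour (y j) u ≡ leftNeighbour (λ a → bar (y J′ a)) u
      above-and-left with proj₂ (pivotCross-just n (agree j j′) u eq)
      ... | inj₁ (refl , all) = (λ a _ → all a) , refl
      ... | inj₂ (v , refl , v< , zv , rest) = same-pivot-above rest , sym (begin
        bar (y J′ v)   ≡⟨ cong bar (Raise.y-elsewhere j′ (suc v) u≤ y′u≡0 v (<⇒≤ v<) (<⇒≢ (n<1+n v))) ⟩
        bar (y j′ v)   ≡⟨ ≢⇒bar≡ (y j v) (y j′ v) (bit≤1 j (p v)) (bit≤1 j′ (p v)) (disagree⇒ j j′ v zv) ⟩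
        y j v          ∎)
        where open ≡-Reasoning
      open RaisedPair j j′ u u≤ yu≡0 y′u≡0 (proj₁ above-and-left) last
      left = leftNeighbour (y j) u
      flips : ∀ d → d ≤ 1 → qsigns 1 2 d J J′ ≈ ν ⊛ qsigns 1 2 d j j′
      flips d d≤1 = flip-cross _ _ _ _ (Q j) (Q̄ J′) left (rightNeighbour (suc n) (y j) u)
                               (rightNeighbour (suc n) (λ a → bar (y J′ a)) u) d (bar d) (yLast j) (yLast J)
        (cong (_+ d * yLast J) (Raise.Q-raise j u u≤ yu≡0))
        (cong (λ b → Q̄ J′ + bar d * b) yLast-raised≡)
        refl
        (cong₂ (λ x b → x + bar d * b)
               (trans (Raise.Q̄-raise j′ u u≤ y′u≡0) (cong (λ l → Q̄ J′ + (l + rightNeighbour (suc n) (λ a → bar (y J′ a)) u)) (sym (proj₂ above-and-left))))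
               yLast≡)
        (b+bar≡1 d d≤1)
        right-and-last

    boundary₀₂ : ∀ j j′ → j < M → j′ < M → yLast j′ ≡ 0 → Φq 0 2 j j′ ≈ 0#
    boundary₀₂ j j′ j< j′< yLast≡0 = unpaired-cancel 0 2 j j′ j< j′< 0<4 2<4 flip
      where
      parity : ∀ X → 1 + (X + 0 * 0) + 2 * 0 ≡ suc (0 + (X + 1 * 0)) + 2 * 0
      parity = ℕ-Solver.solve-∀
      flip : qsigns 0 2 1 j j′ ≈ ν ⊛ qsigns 0 2 0 j j′
      flip rewrite yLast≡0 = ν^-flip 1 (Q̄ j′ + 0 * 0) 0 (Q̄ j′ + 1 * 0) 0 0 (parity (Q̄ j′))

    boundary₁₃ : ∀ j j′ → j < M → j′ < M → yLast j ≡ 1 → Φq 1 3 j j′ ≈ 0#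
    boundary₁₃ j j′ j< j′< yLast≡1 = unpaired-cancel 1 3 j j′ j< j′< 1<4 3<4 flip
      where
      parity : ∀ X → (X + 1 * 1) + 1 + 2 * 0 ≡ suc ((X + 0 * 1) + 1) + 2 * 0
      parity = ℕ-Solver.solve-∀
      flip : qsigns 1 3 1 j j′ ≈ ν ⊛ qsigns 1 3 0 j j′
      flip rewrite yLast≡1 = ν^-flip (Q j + 1 * 1) 1 (Q j + 0 * 1) 1 0 0 (parity (Q j))

    private
      weighted-complement : ∀ w b → b ≤ 1 → w * b + w * bar b ≡ w
      weighted-complement w b b≤1 = trans (sym (*-distribˡ-+ w b (bar b))) (trans (cong (w *_) (b+bar≡1 b b≤1)) (*-identityʳ w))

    linear-complement : ∀ x x̄ → (∀ c → c < r → bit x̄ c ≡ bar (bit x c)) → linear x + linear x̄ ≡ sumN r eₙ + sumN r fₙ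
    linear-complement x x̄ x̄≡ = begin
      (linear₁ x + linear₂ x) + (linear₁ x̄ + linear₂ x̄)   ≡⟨ interchange (linear₁ x) (linear₂ x) (linear₁ x̄) (linear₂ x̄) ⟩
      (linear₁ x + linear₁ x̄) + (linear₂ x + linear₂ x̄)   ≡⟨ cong₂ _+_ (trans (sumN-+ r (λ c → eₙ c * bit x c) (λ c → eₙ c * bit x̄ c)) (sumN-cong r _ eₙ e-terms))
                                                                        (trans (sumN-+ r (λ c → fₙ c * bar (bit x c)) (λ c → fₙ c * bar (bit x̄ c))) (sumN-cong r _ fₙ f-terms)) ⟩
      sumN r eₙ + sumN r fₙ                                 ∎
      where
      open ≡-Reasoning
      e-terms : ∀ c → c < r → eₙ c * bit x c + eₙ c * bit x̄ c ≡ eₙ c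
      e-terms c c< = trans (cong (λ b → eₙ c * bit x c + eₙ c * b) (x̄≡ c c<)) (weighted-complement (eₙ c) (bit x c) (bit≤1 x c))
      f-terms : ∀ c → c < r → fₙ c * bar (bit x c) + fₙ c * bar (bit x̄ c) ≡ fₙ c
      f-terms c c< = begin
        fₙ c * bar (bit x c) + fₙ c * bar (bit x̄ c)          ≡⟨ cong (λ b → fₙ c * bar (bit x c) + fₙ c * bar b) (x̄≡ c c<) ⟩
        fₙ c * bar (bit x c) + fₙ c * bar (bar (bit x c))    ≡⟨ weighted-complement (fₙ c) (bar (bit x c)) (m∸n≤m 1 (bit x c)) ⟩
        fₙ c                                                  ∎

    L : ℕ
    L = M ∸ 1

    M≡1+L : M ≡ suc L
    M≡1+L = sym (trans (+-comm 1 L) (m∸n+n≡m (m^n>0 2 r)))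

    L<M : L < M
    L<M = subst (L <_) (sym M≡1+L) ≤-refl

    module BoundaryPair (j′ j̄ : ℕ) (complement : j′ + j̄ + 1 ≡ M) where
      0<M : 0 < M
      0<M = m^n>0 2 r
      j′<M : j′ < M
      j′<M = subst (j′ <_) complement (subst (_≤ j′ + j̄ + 1) (+-comm j′ 1) (subst (j′ + 1 ≤_) (xy∙z≈xz∙y j′ 1 j̄) (m≤m+n (j′ + 1) j̄)))
      j̄<M : j̄ < M
      j̄<M = subst (j̄ <_) complement (subst (_≤ j′ + j̄ + 1) (+-comm j̄ 1) (subst (j̄ + 1 ≤_) (sym (+-assoc j′ j̄ 1)) (m≤n+m (j̄ + 1) j′)))
      bit-j̄ : ∀ c → c < r → bit j̄ c ≡ bar (bit j′ c)
      bit-j̄ = bit-complement r j′ j̄ complement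
      bit-L : ∀ c → c < r → bit L c ≡ bar (bit 0 c)
      bit-L = bit-complement r 0 L (trans (+-comm L 1) (sym M≡1+L))
      y-j̄ : ∀ a → a ≤ suc n → y j̄ a ≡ bar (y j′ a)
      y-j̄ a a≤ = bit-j̄ (p a) (p-< a (s≤s a≤))
      Q̄-complement : Q̄ j̄ ≡ Q j′
      Q̄-complement = sumN-cong (suc n) _ _ λ i i< →
        cong₂ _*_ (trans (cong bar (y-j̄ i (<⇒≤ i<))) (bar-involutive (y j′ i) (bit≤1 j′ (p i))))
                  (trans (cong bar (y-j̄ (suc i) i<)) (bar-involutive (y j′ (suc i)) (bit≤1 j′ (p (suc i)))))
      yLast-complement : yLast j̄ ≡ bar (yLast j′)
      yLast-complement = y-j̄ (suc n) ≤-refl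
      Ωdiff-complement : Ωdiff (linear j̄) (linear 0) ≈ Ωdiff (linear L) (linear j′)
      Ωdiff-complement = Ωdiff-cong (linear j̄) (linear 0) (linear L) (linear j′)
        (trans (+-comm (linear j̄) (linear j′)) (trans (linear-complement j′ j̄ bit-j̄) (sym (trans (+-comm (linear L) (linear 0)) (linear-complement 0 L bit-L)))))

      boundary-pair : Φq 0 1 L j′ ⊕ Φq 2 3 j̄ 0 ≈ 0#
      boundary-pair with bit-binary j′ (p (suc n))
      ... | inj₁ yLast≡0 = ≈-trans (⊕-cong (unpaired-cancel 0 1 L j′ L<M j′<M 0<4 1<4 flip₀₁)
                                            (unpaired-cancel 2 3 j̄ 0 j̄<M 0<M 2<4 3<4 (ν*-swap _ _ flip₂₃)))
                                   (⊕-identityˡ 0#)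
        where
        flip₀₁ : qsigns 0 1 1 L j′ ≈ ν ⊛ qsigns 0 1 0 L j′
        flip₀₁ rewrite yLast≡0 = ν^-flip 1 (Q j′ + 1 * 0) 0 (Q j′ + 0 * 0) 0 0 (parity₀₁ (Q j′))
          where
          parity₀₁ : ∀ X → 1 + (X + 1 * 0) + 2 * 0 ≡ suc (0 + (X + 0 * 0)) + 2 * 0
          parity₀₁ = ℕ-Solver.solve-∀
        flip₂₃ : qsigns 2 3 0 j̄ 0 ≈ ν ⊛ qsigns 2 3 1 j̄ 0
        flip₂₃ rewrite Q̄-complement | yLast-complement | yLast≡0 = ν^-flip (Q j′ + 1 * 1) 1 (Q j′ + 0 * 1) 1 0 0 (parity₂₃ (Q j′))
          where
          parity₂₃ : ∀ X → (X + 1 * 1) + 1 + 2 * 0 ≡ suc ((X + 0 * 1) + 1) + 2 * 0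
          parity₂₃ = ℕ-Solver.solve-∀
      ... | inj₂ yLast≡1 = ≈-trans (⊕-comm _ _) (≈-trans (⊕-cong (Φq≈ 2 3 j̄ 0 j̄<M 0<M 2<4 3<4) (Φq≈ 0 1 L j′ L<M j′<M 0<4 1<4))
                                                        (cancel-pair _ _ _ _ _ _ flip₀ flip₁ Ωdiff-complement))
        where
        flip₀ : qsigns 2 3 0 j̄ 0 ≈ ν ⊛ qsigns 0 1 0 L j′
        flip₀ rewrite Q̄-complement | yLast-complement | yLast≡1 = ν^-flip (Q j′ + 1 * 0) 1 0 (Q j′ + 0 * 1) 0 0 (parity₀ (Q j′))
          where
          parity₀ : ∀ X → (X + 1 * 0) + 1 + 2 * 0 ≡ suc (0 + (X + 0 * 1)) + 2 * 0
          parity₀ = ℕ-Solver.solve-∀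
        flip₁ : qsigns 2 3 1 j̄ 0 ≈ ν ⊛ qsigns 0 1 1 L j′
        flip₁ rewrite Q̄-complement | yLast≡1 = ν^-flip (Q j′ + 0 * 0) 1 1 (Q j′ + 1 * 1) 1 0 (parity₁ (Q j′))
          where
          parity₁ : ∀ X → (X + 0 * 0) + 1 + 2 * 1 ≡ suc (1 + (X + 1 * 1)) + 2 * 0
          parity₁ = ℕ-Solver.solve-∀

    open BoundaryPair using (boundary-pair)

    private
      shift≢ : ∀ t τ → 1 ≤ τ → t + 0 ≢ t + τ
      shift≢ t τ 1≤τ eq = <⇒≢ 1≤τ (+-cancelˡ-≡ t 0 τ eq)

    segment₁₁ : ∀ K τ → K + 0 + τ ≡ M → 1 ≤ τ → sumR R K (λ t → Φq 1 1 (t + 0) (t + τ)) ≈ 0#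
    segment₁₁ K τ K+τ≡M 1≤τ = PivotInvolution.segment-sum≈0 R dom char0 n π (pivotSame n) (pivotSame-cong n) (pivotSame-true n)
      (Φq 1 1) K 0 τ (inj₁ refl) K+τ≡M
      (λ t t< → unpaired₁₁ (t + 0) (t + τ) (proj₁ (offsets-< t< K+τ≡M)) (proj₂ (offsets-< t< K+τ≡M)) (shift≢ t τ 1≤τ))
      paired₁₁

    segment₂₂ : ∀ K τ → K + 0 + τ ≡ M → 1 ≤ τ → sumR R K (λ t → Φq 2 2 (t + 0) (t + τ)) ≈ 0#
    segment₂₂ K τ K+τ≡M 1≤τ = PivotInvolution.segment-sum≈0 R dom char0 n π (pivotSame n) (pivotSame-cong n) (pivotSame-true n)
      (Φq 2 2) K 0 τ (inj₁ refl) K+τ≡M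
      (λ t t< → unpaired₂₂ (t + 0) (t + τ) (proj₁ (offsets-< t< K+τ≡M)) (proj₂ (offsets-< t< K+τ≡M)) (shift≢ t τ 1≤τ))
      paired₂₂

    segment₁₂ : ∀ K D₁ D₂ → D₁ ≡ 0 ⊎ D₂ ≡ 0 → K + D₁ + D₂ ≡ M → sumR R K (λ t → Φq 1 2 (t + D₁) (t + D₂)) ≈ 0#
    segment₁₂ K D₁ D₂ D≡0 K+D≡M = PivotInvolution.segment-sum≈0 R dom char0 n π (pivotCross n) (pivotCross-cong n) (pivotCross-true n)
      (Φq 1 2) K D₁ D₂ D≡0 K+D≡M
      (λ t t< → unpaired₁₂ (t + D₁) (t + D₂) (proj₁ (offsets-< t< K+D≡M)) (proj₂ (offsets-< t< K+D≡M)))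
      paired₁₂

    N : ℕ
    N = 2 + 2 * M

    -- ρ_a(τ) + ρ_b(τ) is the sum of term τ k over k < N ∸ τ.
    term : ℕ → ℕ → Carrier
    term τ k = Φ (k + L) (k + τ + L)

    private
      1+X+L≡X+M : ∀ X → suc X + L ≡ X + M
      1+X+L≡X+M X = trans (sym (+-suc X L)) (cong (X +_) (sym M≡1+L))

      L≡L+M*0 : L ≡ L + M * 0
      L≡L+M*0 = sym (trans (cong (L +_) (*-zeroʳ M)) (+-identityʳ L))

      X+M≡X+M*1 : ∀ X → X + M ≡ X + M * 1
      X+M≡X+M*1 X = cong (X +_) (sym (*-identityʳ M))

      2^p≤M : 2 ^ p (suc n) ≤ M
      2^p≤M = ^-monoʳ-≤ 2 (<⇒≤ (p-< (suc n) ≤-refl))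

    -- The index equations may be stated for any m ≡ M, so that M can be replaced by D + τ.
    term-at : ∀ τ X {j w j′ w′} m → m ≡ M → X + m ≡ j + m * w → X + τ + m ≡ j′ + m * w′ → term τ (suc X) ≡ Φq w w′ j j′
    term-at τ X m refl eq eq′ = cong₂ Φ (trans (1+X+L≡X+M X) eq) (trans (1+X+L≡X+M (X + τ)) eq′)

    block≈0 : ∀ τ O K {w w′ D₁ D₂} m → m ≡ M → (∀ t → O + t + m ≡ (t + D₁) + m * w) → (∀ t → O + t + τ + m ≡ (t + D₂) + m * w′)
              → sumR R K (λ t → Φq w w′ (t + D₁) (t + D₂)) ≈ 0# → sumR R K (λ t → term τ (suc (O + t))) ≈ 0#
    block≈0 τ O K m m≡M idx idx′ segment =
      ≈-trans (sumR-cong R K _ _ (λ t _ → ≈-reflexive (term-at τ (O + t) m m≡M (idx t) (idx′ t)))) segment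

    private
      short-count : ∀ D τ → 2 + 2 * (D + τ) ≡ (1 + ((D + τ) + (D + 1))) + τ
      short-count = ℕ-Solver.solve-∀
      long-count : ∀ D s → 2 + 2 * (D + s) ≡ (1 + (D + 1)) + ((D + s) + s)
      long-count = ℕ-Solver.solve-∀
      complement-sum : ∀ τ′ D → τ′ + D + 1 ≡ D + suc τ′
      complement-sum = ℕ-Solver.solve-∀
      index₀₂ : ∀ s′ m → m + s′ + m ≡ s′ + m * 2
      index₀₂ = ℕ-Solver.solve-∀
      index₁₁ : ∀ t m → t + m ≡ (t + 0) + m * 1
      index₁₁ = ℕ-Solver.solve-∀
      index₁₂ : ∀ t D m → D + t + m ≡ (t + D) + m * 1
      index₁₂ = ℕ-Solver.solve-∀
      index₁₂′ : ∀ t D τ → D + t + τ + (D + τ) ≡ (t + 0) + (D + τ) * 2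
      index₁₂′ = ℕ-Solver.solve-∀
      index₁₂″ : ∀ t m s → t + (m + s) + m ≡ (t + s) + m * 2
      index₁₂″ = ℕ-Solver.solve-∀
      index₁₃ : ∀ D m → D + 0 + m ≡ D + m * 1
      index₁₃ = ℕ-Solver.solve-∀
      index₁₃′ : ∀ D s → D + 0 + ((D + s) + s) + (D + s) ≡ 0 + (D + s) * 3
      index₁₃′ = ℕ-Solver.solve-∀
      index₂₂ : ∀ t D τ → D + τ + t + (D + τ) ≡ (t + 0) + (D + τ) * 2
      index₂₂ = ℕ-Solver.solve-∀
      index₂₂′ : ∀ t D τ → D + τ + t + τ + (D + τ) ≡ (t + τ) + (D + τ) * 2
      index₂₂′ = ℕ-Solver.solve-∀
      index₂₃ : ∀ D τ → D + τ + (D + 0) + (D + τ) ≡ D + (D + τ) * 2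
      index₂₃ = ℕ-Solver.solve-∀
      index₂₃′ : ∀ D τ → D + τ + (D + 0) + τ + (D + τ) ≡ 0 + (D + τ) * 3
      index₂₃′ = ℕ-Solver.solve-∀

    -- For 0 < τ ≤ M the window meets the quadrants 0|1, 1|1, 1|2, 2|2 and 2|3.
    short-lag : ∀ τ′ D → D + suc τ′ ≡ M → sumR R (N ∸ suc τ′) (term (suc τ′)) ≈ 0#
    short-lag τ′ D D+τ≡M = begin
      sumR R (N ∸ τ) h₀
        ≡⟨ cong (λ K → sumR R K h₀) count ⟩
      sumR R (1 + ((D + τ) + (D + 1))) h₀
        ≈⟨ ≈-trans (sumR-cons R _ h₀) (⊕-congˡ (≈-trans (sumR-split R (D + τ) _ h₁) (⊕-cong (sumR-split R D τ h₁) (sumR-snoc R D h₃)))) ⟩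
      h₀ 0 ⊕ ((sumR R D h₁ ⊕ sumR R τ h₂) ⊕ (sumR R D h₃ ⊕ h₃ (D + 0)))
        ≈⟨ ⊕-congˡ (⊕-cong (≈-trans (⊕-cong within₁₁ within₁₂) (⊕-identityˡ 0#)) (≈-trans (⊕-congʳ within₂₂) (⊕-identityˡ _))) ⟩
      h₀ 0 ⊕ (0# ⊕ h₃ (D + 0))
        ≈⟨ ⊕-congˡ (⊕-identityˡ _) ⟩
      h₀ 0 ⊕ h₃ (D + 0)
        ≡⟨ cong₂ _⊕_ (cong₂ Φ L≡L+M*0 (trans (1+X+L≡X+M τ′) (X+M≡X+M*1 τ′))) (term-at τ _ (D + τ) D+τ≡M (index₂₃ D τ) (index₂₃′ D τ)) ⟩
      Φq 0 1 L τ′ ⊕ Φq 2 3 D 0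
        ≈⟨ boundary-pair τ′ D (trans (complement-sum τ′ D) D+τ≡M) ⟩
      0#  ∎
      where
      open import Relation.Binary.Reasoning.Setoid (CommutativeRing.setoid R)
      τ = suc τ′
      h₀ h₁ h₂ h₃ : ℕ → Carrier
      h₀ = term τ
      h₁ t = h₀ (suc t)
      h₂ t = h₁ (D + t)
      h₃ t = h₁ (D + τ + t)
      D+0+τ≡M : D + 0 + τ ≡ M
      D+0+τ≡M = trans (cong (_+ τ) (+-identityʳ D)) D+τ≡M
      count : N ∸ τ ≡ 1 + ((D + τ) + (D + 1))
      count = trans (cong (λ m → (2 + 2 * m) ∸ τ) (sym D+τ≡M)) (trans (cong (_∸ τ) (short-count D τ)) (m+n∸n≡m _ τ))
      within₁₁ : sumR R D h₁ ≈ 0#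
      within₁₁ = block≈0 τ 0 D M refl (λ t → index₁₁ t M) (λ t → X+M≡X+M*1 (t + τ)) (segment₁₁ D τ D+0+τ≡M (s≤s z≤n))
      within₁₂ : sumR R τ h₂ ≈ 0#
      within₁₂ = block≈0 τ D τ (D + τ) D+τ≡M (λ t → index₁₂ t D (D + τ)) (λ t → index₁₂′ t D τ)
                         (segment₁₂ τ D 0 (inj₂ refl) (trans (+-identityʳ _) (trans (+-comm τ D) D+τ≡M)))
      within₂₂ : sumR R D h₃ ≈ 0#
      within₂₂ = block≈0 τ (D + τ) D (D + τ) D+τ≡M (λ t → index₂₂ t D τ) (λ t → index₂₂′ t D τ) (segment₂₂ D τ D+0+τ≡M (s≤s z≤n))

    -- For M < τ ≤ M + 2 ^ π(m-3) only the quadrant pairs 0|2, 1|2 and 1|3 remain, and the two boundary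
    -- terms vanish because the bit x_{π(m-3)} of τ - M - 1 is 0.
    long-lag : ∀ s′ D → D + suc s′ ≡ M → suc s′ ≤ 2 ^ p (suc n) → sumR R (N ∸ (M + suc s′)) (term (M + suc s′)) ≈ 0#
    long-lag s′ D D+s≡M s≤2^p = begin
      sumR R (N ∸ τ) h₀                         ≡⟨ cong (λ K → sumR R K h₀) count ⟩
      sumR R (1 + (D + 1)) h₀                   ≈⟨ ≈-trans (sumR-cons R _ h₀) (⊕-congˡ (sumR-snoc R D h₁)) ⟩
      h₀ 0 ⊕ (sumR R D h₁ ⊕ h₁ (D + 0))         ≈⟨ ⊕-cong first≈0 (≈-trans (⊕-cong within₁₂ last≈0) (⊕-identityˡ 0#)) ⟩
      0# ⊕ 0#                                   ≈⟨ ⊕-identityˡ 0# ⟩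
      0#                                        ∎
      where
      open import Relation.Binary.Reasoning.Setoid (CommutativeRing.setoid R)
      s = suc s′
      τ = M + s
      h₀ h₁ : ℕ → Carrier
      h₀ = term τ
      h₁ t = h₀ (suc t)
      count : N ∸ τ ≡ 1 + (D + 1)
      count = trans (cong (λ m → (2 + 2 * m) ∸ (m + s)) (sym D+s≡M)) (trans (cong (_∸ ((D + s) + s)) (long-count D s)) (m+n∸n≡m _ ((D + s) + s)))
      s′<2^p : s′ < 2 ^ p (suc n)
      s′<2^p = s≤2^p
      first≈0 : h₀ 0 ≈ 0#
      first≈0 = ≈-trans (≈-reflexive (cong₂ Φ L≡L+M*0 (trans (cong (_+ L) (+-suc M s′)) (trans (1+X+L≡X+M (M + s′)) (index₀₂ s′ M)))))
                        (boundary₀₂ L s′ L<M (≤-trans s′<2^p 2^p≤M) (bit-<2^ s′ (p (suc n)) s′<2^p))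
      within₁₂ : sumR R D h₁ ≈ 0#
      within₁₂ = block≈0 τ 0 D M refl (λ t → index₁₁ t M) (λ t → index₁₂″ t M s)
                         (segment₁₂ D 0 s (inj₁ refl) (trans (cong (_+ s) (+-identityʳ D)) D+s≡M))
      last-index : D + 0 + (M + s) + M ≡ 0 + M * 3
      last-index = subst (λ m → D + 0 + (m + s) + m ≡ 0 + m * 3) D+s≡M (index₁₃′ D s)
      complement : s′ + D + 1 ≡ M
      complement = trans (+-comm (s′ + D) 1) (trans (cong suc (+-comm s′ D)) (trans (sym (+-suc D s′)) D+s≡M))
      yLast-D : yLast D ≡ 1
      yLast-D = trans (bit-complement r s′ D complement (p (suc n)) (p-< (suc n) ≤-refl)) (cong bar (bit-<2^ s′ (p (suc n)) s′<2^p))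
      last≈0 : h₁ (D + 0) ≈ 0#
      last≈0 = ≈-trans (≈-reflexive (term-at τ (D + 0) M refl (index₁₃ D M) last-index))
                       (boundary₁₃ D 0 (subst (D <_) D+s≡M (m<m+n D (s≤s z≤n))) (m^n>0 2 r) yLast-D)

    correlation≈0 : ∀ τ → 1 ≤ τ → τ ≤ M + 2 ^ p (suc n) → sumR R (N ∸ τ) (term τ) ≈ 0#
    correlation≈0 (suc τ′) _ τ≤ with suc τ′ ≤? M
    ... | yes τ≤M = short-lag τ′ (M ∸ suc τ′) (m∸n+n≡m τ≤M)
    ... | no  τ≰M = subst (λ z → sumR R (N ∸ z) (term z) ≈ 0#) τ≡ (long-lag s′ (M ∸ suc s′) (m∸n+n≡m s≤M) s≤2^p)
      where
      M≤τ′ : M ≤ τ′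
      M≤τ′ = ≤-pred (≰⇒> τ≰M)
      s′ = τ′ ∸ M
      τ≡ : M + suc s′ ≡ suc τ′
      τ≡ = trans (+-suc M s′) (cong suc (m+[n∸m]≡n M≤τ′))
      s≤2^p : suc s′ ≤ 2 ^ p (suc n)
      s≤2^p = +-cancelˡ-≤ M (suc s′) (2 ^ p (suc n)) (subst (_≤ M + 2 ^ p (suc n)) (sym τ≡) τ≤)
      s≤M : suc s′ ≤ M
      s≤M = ≤-trans s≤2^p 2^p≤M

    is-ZCP : IsZCP R q ω N (ΨL L (G 0)) (ΨL L (G 1)) (M + 2 ^ p (suc n) + 1)
    is-ZCP τ 1≤τ τ≤ = ≈-trans (sumR-+ R (N ∸ τ) _ _) (correlation≈0 τ 1≤τ (subst (τ ≤_) (m+n∸n≡m _ 1) τ≤))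

    is-ZCP-at : ∀ {N′ L′ Z′} → N′ ≡ N → L′ ≡ L → Z′ ≡ M + 2 ^ p (suc n) + 1 → IsZCP R q ω N′ (ΨL L′ (G 0)) (ΨL L′ (G 1)) Z′
    is-ZCP-at refl refl refl = is-ZCP

    private
      m-2≡r : n + 4 ∸ 2 ≡ r
      m-2≡r = cong (_∸ 2) (+-comm n 4)

    offset≡ : 2 ^ (n + 4 ∸ 2) ∸ 1 ≡ L
    offset≡ = cong (λ z → 2 ^ z ∸ 1) m-2≡r

    length≡ : 2 ^ (n + 4) ∸ 2 * (2 ^ (n + 4 ∸ 2) ∸ 1) ≡ N
    length≡ = begin
      2 ^ (n + 4) ∸ 2 * (2 ^ (n + 4 ∸ 2) ∸ 1)   ≡⟨ cong₂ (λ a b → 2 ^ a ∸ 2 * b) (+-comm n 4) offset≡ ⟩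
      2 * (2 * M) ∸ 2 * L                        ≡⟨ cong (λ z → 2 * (2 * z) ∸ 2 * L) M≡1+L ⟩
      2 * (2 * suc L) ∸ 2 * L                    ≡⟨ cong (_∸ 2 * L) (regroup L) ⟩
      2 * L + (2 + 2 * suc L) ∸ 2 * L            ≡⟨ m+n∸m≡n (2 * L) _ ⟩
      2 + 2 * suc L                              ≡⟨ cong (λ z → 2 + 2 * z) M≡1+L ⟨
      N                                          ∎
      where
      open ≡-Reasoning
      regroup : ∀ L → 2 * (2 * suc L) ≡ 2 * L + (2 + 2 * suc L)
      regroup = ℕ-Solver.solve-∀

    N≡2^[m-1]+2 : N ≡ 2 ^ (n + 4 ∸ 1) + 2
    N≡2^[m-1]+2 = trans (+-comm 2 (2 * M)) (cong (λ z → 2 ^ z + 2) (sym (cong (_∸ 1) (+-comm n 4))))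

    width≡ : 2 ^ (n + 4 ∸ 2) + 2 ^ toℕ (π ⟨$⟩ʳ fromℕ (suc n)) + 1 ≡ M + 2 ^ p (suc n) + 1
    width≡ = cong₂ (λ a b → 2 ^ a + 2 ^ b + 1) m-2≡r (sym (trans (cong p (sym (toℕ-fromℕ (suc n)))) (p-toℕ (fromℕ (suc n)))))

open import Defs
open import Level using (Level)
open import Algebra.Bundles using (CommutativeRing)
open import Data.Nat using (ℕ; suc; _+_; _*_; _∸_; _^_; _≤_; z≤n; s≤s)
open import Data.Nat.Properties using (m≤m*n)
open import Data.Nat.Divisibility using (_∣_; divides)
open import Data.Fin using (Fin; toℕ; fromℕ)
open import Data.Fin.Permutation using (Permutation′; _⟨$⟩ʳ_)
open import Data.Product using (_×_; _,_)
open import Relation.Binary.PropositionalEquality using (_≡_; refl; trans)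

theorem1 : ∀ {c ℓ : Level} (R : CommutativeRing c ℓ) (ω : CommutativeRing.Carrier R)
  → IsIntegralDomain R → CharZero R
  → (q : ℕ) → 2 ≤ q → 2 ∣ q → IsPrimitiveRoot R q ω
  → (n : ℕ) → (π : Permutation′ (suc (suc n)))
  → (e f : Fin (suc (suc n)) → Fin q)
  → let m = n + 4
        L = 2 ^ (m ∸ 2) ∸ 1
        N = 2 ^ m ∸ 2 * L
        a = ΨL L (g q n π e f 0)
        b = ΨL L (g q n π e f 1)
    in (N ≡ 2 ^ (m ∸ 1) + 2)
       × IsZCP R q ω N a b (2 ^ (m ∸ 2) + 2 ^ toℕ (π ⟨$⟩ʳ fromℕ (suc n)) + 1)
theorem1 R ω dom char0 .(0 * 2) () (divides 0 refl) _ n π e f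
theorem1 R ω dom char0 .(suc k * 2) _ (divides (suc k) refl) (ω^q≈1 , minimal) n π e f
  = trans C.length≡ C.N≡2^[m-1]+2 , C.is-ZCP-at C.length≡ C.offset≡ C.width≡
  where
  module C = Correlations.Correlation R dom char0 k ω ω^q≈1 (minimal (suc k) (s≤s z≤n) (s≤s (s≤s (m≤m*n k 2)))) n π e f
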